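{- Let $m>n$ with $n\equiv 2\pmod 4$. If a Hamilton cycle of $G(m,n)$ with exactly $k$ straights has an unfolding line, then there exists a Hamilton cycle of $G(m+6,n)$ with exactly $k+4$ straights which has an unfolding line. Furthermore, if the original cycle contains a $T$ or a $U$ at some corner and has an unfolding line crossed by no edge of that $T$ or $U$, then the new cycle can also be chosen to contain a $T$ or a $U$ at some corner together with an unfolding line crossed by no edge of that $T$ or $U$.
   Context: $G(m,n)$ is the graph on cells $\{1,\dots,m\}\times\{1,\dots,n\}$ with $(a,b),(c,d)$ adjacent iff $|a-c|+|b-d|=1$; row $y$ is the set of cells with second coordinate $y$. A Hamilton cycle is a cycle through every cell. A turn is a cell whose two incident cycle edges are one horizontal and one vertical; a straight is a cell of the cycle that is not a turn. A set $S$ of positive integers is evenly extensible with respect to $n$ if $|S|=\frac n2-1$, $S$ contains at most one element of each set $\{2a-1,2a\}$ ($a$ a positive integer), and there is a unique integer $1\le a\le \frac n2$ such that $S$ contains neither $2a-1$ nor $2a$, and for this $a$, $S$ contains at least one of $2a-2$ and $2a+1$. For a Hamilton cycle of $G(m,n)$, the vertical line separating columns $x$ and $x+1$ ($1\le x<m$) is an unfolding line if the set of rows $y$ for which the cycle uses the edge between $(x,y)$ and $(x+1,y)$ is evenly extensible with respect to $n$; an edge crosses the line if it is such an edge. For a corner cell $c$, let $u,v$ be the two unit vectors pointing from $c$ into the grid along the two boundary sides at $c$ (in either assignment). The cycle contains a $T$ at $c$ if it contains the path $c,c+u,c+2u,c+3u$; it contains a $U$ at $c$ if it contains the path $c+3u+2v,\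 c+3u+v,\ c+3u,\ c+2u,\ c+2u+v,\ c+u+v,\ c+u,\ c,\ c+v,\ c+2v$ (consecutive cells joined by cycle edges). -}

module Defs where

open import Data.Nat using (ℕ; zero; suc; _+_; _*_; _∸_; _≤_; _<_; ∣_-_∣; _≡ᵇ_)
open import Data.Nat.DivMod using (_/_)
open import Data.Bool using (Bool; true; false; _∧_; _∨_; not; if_then_else_)
open import Data.Product using (Σ; ∃; ∃-syntax; _×_; _,_; proj₁; proj₂)
open import Data.Sum using (_⊎_)
open import Data.List using (List; []; _∷_; length; map; upTo)
open import Data.Nat.ListAction using (sum)
open import Data.Unit using (⊤)
open import Data.List.Relation.Unary.Unique.Propositional using (Unique)
open import Data.List.Membership.Propositional using (_∈_)
open import Relation.Binary.PropositionalEquality using (_≡_)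
open import Relation.Nullary using (¬_)
open import Function.Bundles using (_⇔_)

-- Cells of G(m,n): pairs (a,b) of naturals with 1 ≤ a ≤ m, 1 ≤ b ≤ n
-- (1-based, exactly as in the paper).

Cell : Set
Cell = ℕ × ℕ

InGrid : ℕ → ℕ → Cell → Set
InGrid m n (a , b) = (1 ≤ a × a ≤ m) × (1 ≤ b × b ≤ n)

Adj : Cell → Cell → Set
Adj (a , b) (c , d) = ∣ a - c ∣ + ∣ b - d ∣ ≡ 1

record HamCycle (m n : ℕ) : Set where
  field
    cell       : ℕ → Cell
    periodic   : ∀ i → cell (i + m * n) ≡ cell i
    inGrid     : ∀ i → InGrid m n (cell i)
    injective  : ∀ i j → i < m * n → j < m * n → cell i ≡ cell j → i ≡ j
    surjective : ∀ p → InGrid m n p → ∃[ i ] (i < m * n × cell i ≡ p)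
    adjacent   : ∀ i → Adj (cell i) (cell (suc i))

open HamCycle public

UsesEdge : ∀ {m n} → HamCycle m n → Cell → Cell → Set
UsesEdge C p q =
  ∃[ i ] ((cell C i ≡ p × cell C (suc i) ≡ q) ⊎ (cell C i ≡ q × cell C (suc i) ≡ p))

-- Turns and straights.  An edge between adjacent cells is horizontal
-- iff both cells lie in the same row (same second coordinate).

isHorizontal : Cell → Cell → Bool
isHorizontal (a , b) (c , d) = b ≡ᵇ d

-- The cell at position i (i ≥ 1) of the cycle is a straight iff its two
-- incident cycle edges (to positions i-1 and i+1) are both horizontal or
-- both vertical; otherwise it is a turn.
isStraightAt : ∀ {m n} → HamCycle m n → ℕ → Bool
isStraightAt C i =
  let h₁ = isHorizontal (cell C (i ∸ 1)) (cell C i)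
      h₂ = isHorizontal (cell C i) (cell C (suc i))
  in (h₁ ∧ h₂) ∨ (not h₁ ∧ not h₂)

-- number of straights: count over positions 1, …, m*n (one period,
-- i.e. each cell of the grid exactly once)
numStraights : ∀ {m n} → HamCycle m n → ℕ
numStraights {m} {n} C =
  sum (map (λ i → if isStraightAt C (suc i) then 1 else 0) (upTo (m * n)))

-- Evenly extensible sets (S a set of positive integers, given as a
-- predicate on ℕ; |S| is expressed via a duplicate-free list listing S).

EvenlyExtensible : ℕ → (ℕ → Set) → Set
EvenlyExtensible n S =
    (∀ y → S y → 1 ≤ y)
  × (∃[ L ] (Unique L × (∀ y → (y ∈ L) ⇔ S y) × length L ≡ n / 2 ∸ 1))
  × (∀ a → 1 ≤ a → ¬ (S (2 * a ∸ 1) × S (2 * a)))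
  × (∃[ a ] ( (1 ≤ a × a ≤ n / 2)
            × ¬ S (2 * a ∸ 1) × ¬ S (2 * a)
            × (∀ b → 1 ≤ b → b ≤ n / 2 → ¬ S (2 * b ∸ 1) → ¬ S (2 * b) → b ≡ a)
            × (S (2 * a ∸ 2) ⊎ S (2 * a + 1))))

CrossSet : ∀ {m n} → HamCycle m n → ℕ → ℕ → Set
CrossSet {m} {n} C x y = (1 ≤ y × y ≤ n) × UsesEdge C (x , y) (suc x , y)

UnfoldingLine : ∀ {m n} → HamCycle m n → ℕ → Set
UnfoldingLine {m} {n} C x = (1 ≤ x × x < m) × EvenlyExtensible n (CrossSet C x)

HasUnfoldingLine : ∀ {m n} → HamCycle m n → Set
HasUnfoldingLine C = ∃[ x ] UnfoldingLine C x

CrossesLine : ℕ → Cell → Cell → Set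
CrossesLine x p q = ∃[ y ] ((p ≡ (x , y) × q ≡ (suc x , y)) ⊎ (p ≡ (suc x , y) × q ≡ (x , y)))

data Dir : Set where
  right left up down : Dir

step : Dir → Cell → Cell
step right (a , b) = (suc a , b)
step left  (a , b) = (a ∸ 1 , b)
step up    (a , b) = (a , suc b)
step down  (a , b) = (a , b ∸ 1)

mv : ℕ → Dir → Cell → Cell
mv zero    d c = c
mv (suc k) d c = step d (mv k d c)

-- c is a corner cell and u, v are the two inward unit vectors along
-- the two boundary sides at c (in either assignment)
data CornerFrame (m n : ℕ) : Cell → Dir → Dir → Set where
  c11 : CornerFrame m n (1 , 1) right up
  cm1 : CornerFrame m n (m , 1) left up
  c1n : CornerFrame m n (1 , n) right down
  cmn : CornerFrame m n (m , n) left down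
  swp : ∀ {c u v} → CornerFrame m n c u v → CornerFrame m n c v u

Tpath : Cell → Dir → Dir → List Cell
Tpath c u v = c ∷ mv 1 u c ∷ mv 2 u c ∷ mv 3 u c ∷ []

Upath : Cell → Dir → Dir → List Cell
Upath c u v =
    mv 2 v (mv 3 u c) ∷ mv 1 v (mv 3 u c) ∷ mv 3 u c ∷ mv 2 u c
  ∷ mv 1 v (mv 2 u c) ∷ mv 1 v (mv 1 u c) ∷ mv 1 u c ∷ c ∷ mv 1 v c ∷ mv 2 v c ∷ []

AllEdges : (Cell → Cell → Set) → List Cell → Set
AllEdges R []           = ⊤
AllEdges R (p ∷ [])     = ⊤
AllEdges R (p ∷ q ∷ ps) = R p q × AllEdges R (q ∷ ps)

ContainsPath : ∀ {m n} → HamCycle m n → List Cell → Set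
ContainsPath C P = AllEdges (UsesEdge C) P

GoodCorner : ∀ {m n} → HamCycle m n → Set
GoodCorner {m} {n} C =
  ∃[ c ] ∃[ u ] ∃[ v ] ∃[ P ]
    ( CornerFrame m n c u v
    × (P ≡ Tpath c u v ⊎ P ≡ Upath c u v)
    × ContainsPath C P
    × ∃[ x ] (UnfoldingLine C x × AllEdges (λ p q → ¬ CrossesLine x p q) P))

-- Insert six new columns between columns x and x + 1 of the unfolding line.  Every
-- edge of the cycle that crosses the line is replaced by a detour through the new
-- columns: a zigzag filling a 6 × 2 block (no straights) when it crosses in a row of
-- a pair {2a - 1, 2a} occupied by the crossing set, and, for the one crossing next to
-- the unique empty pair, a path filling the 6 × 4 block spanned by both pairs with
-- exactly four straights.  Since each detour starts and ends horizontally, the cells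
-- at its two ends keep their type, so the number of straights grows by exactly 4;
-- the new cycle crosses line x in the same rows, so x is still an unfolding line.
-- A T or U not crossing the line lies on one side of it and is carried over
-- unchanged (translated by 6 on the right side), still at a corner.

module Submission where

open import Defs
open import Data.Bool using (Bool; true; false; _∧_; _∨_; not; if_then_else_)
open import Data.Bool.Properties using (T-≡)
open import Data.Empty using (⊥; ⊥-elim)
open import Data.List using (List; []; _∷_; length; map; applyUpTo; _++_; [_]; reverse)
open import Data.List.Membership.Propositional using (_∈_; _∉_)
open import Data.List.Membership.Propositional.Properties
  using (∈-++⁺ˡ; ∈-++⁺ʳ; ∈-++⁻; ∈-map⁺; ∈-map⁻; ∈-∃++; ∈-applyUpTo⁺; ∈-applyUpTo⁻)
import Data.List.Membership.DecPropositional as DecMembership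
open import Data.List.Properties
  using (length-++; ++-assoc; map-++; map-upTo; applyUpTo-∷ʳ; length-applyUpTo; map-cong-local; map-id-local)
open import Data.List.Relation.Unary.All using (All; all?)
import Data.List.Relation.Unary.All as All
open import Data.List.Relation.Unary.Any using (here; there)
open import Data.List.Relation.Unary.Any.Properties using (reverse⁺; reverse⁻)
open import Data.Nat using (ℕ; zero; suc; _+_; _*_; _∸_; _≤_; _<_; z≤n; s≤s; ∣_-_∣; _≡ᵇ_; _≤?_; _<?_)
open import Data.Nat.Properties
open import Data.Nat.DivMod
  using (_%_; _/_; m≡m%n+[m/n]*n; m%n<n; m<n⇒m%n≡m; n%n≡0; [m+kn]%n≡m%n; [m+n]%n≡m%n; m*n/n≡m)
open import Data.Nat.ListAction using (sum)
open import Data.Nat.Solver using (module +-*-Solver)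
open import Data.Product using (∃-syntax; _×_; _,_; proj₁; proj₂)
import Data.Product as Product
open import Data.Product.Properties using (≡-dec)
open import Data.Sum using (_⊎_; inj₁; inj₂)
import Data.Sum as Sum
open import Data.Unit using (tt)
open import Function using (_∘_)
open import Function.Bundles using (_⇔_; mk⇔; Equivalence)
open import Relation.Binary.PropositionalEquality
  using (_≡_; _≢_; refl; sym; trans; cong; cong₂; subst; subst₂; module ≡-Reasoning)
open import Relation.Nullary using (¬_; Dec; yes; no)
open import Relation.Nullary.Decidable using (_×-dec_; _⊎-dec_; _→-dec_; toWitness; True)

nth : {A : Set} → A → List A → ℕ → A
nth d []       k       = d
nth d (z ∷ zs) zero    = z
nth d (z ∷ zs) (suc k) = nth d zs k

data NoDup {A : Set} : List A → Set where
  []  : NoDup []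
  _∷_ : ∀ {z zs} → z ∉ zs → NoDup zs → NoDup (z ∷ zs)

data Consecutive {A : Set} (a b : A) : List A → Set where
  here₂  : ∀ {zs} → Consecutive a b (a ∷ b ∷ zs)
  there₂ : ∀ {z zs} → Consecutive a b zs → Consecutive a b (z ∷ zs)

module _ {A : Set} (d : A) where

  nth-∈ : ∀ (xs : List A) k → k < length xs → nth d xs k ∈ xs
  nth-∈ (z ∷ xs) zero    _         = here refl
  nth-∈ (z ∷ xs) (suc k) (s≤s k<n) = there (nth-∈ xs k k<n)

  ∈⇒nth : ∀ {z} (xs : List A) → z ∈ xs → ∃[ k ] (k < length xs × nth d xs k ≡ z)
  ∈⇒nth (w ∷ xs) (here refl) = 0 , s≤s z≤n , refl
  ∈⇒nth (w ∷ xs) (there z∈xs) with ∈⇒nth xs z∈xs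
  ... | k , k<n , eq = suc k , s≤s k<n , eq

  nth-injective : ∀ (xs : List A) → NoDup xs → ∀ k k′ → k < length xs → k′ < length xs
    → nth d xs k ≡ nth d xs k′ → k ≡ k′
  nth-injective (z ∷ xs) (z∉ ∷ _)  zero    zero     _         _          _  = refl
  nth-injective (z ∷ xs) (z∉ ∷ _)  zero    (suc k′) _         (s≤s k′<n) eq =
    ⊥-elim (z∉ (subst (_∈ xs) (sym eq) (nth-∈ xs k′ k′<n)))
  nth-injective (z ∷ xs) (z∉ ∷ _)  (suc k) zero     (s≤s k<n) _          eq =
    ⊥-elim (z∉ (subst (_∈ xs) eq (nth-∈ xs k k<n)))
  nth-injective (z ∷ xs) (_ ∷ nd) (suc k) (suc k′) (s≤s k<n) (s≤s k′<n) eq =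
    cong suc (nth-injective xs nd k k′ k<n k′<n eq)

  Consecutive⇒nth : ∀ {a b} (xs : List A) → Consecutive a b xs
    → ∃[ k ] (suc k < length xs × nth d xs k ≡ a × nth d xs (suc k) ≡ b)
  Consecutive⇒nth (a ∷ b ∷ xs) here₂ = 0 , s≤s (s≤s z≤n) , refl , refl
  Consecutive⇒nth (z ∷ xs) (there₂ c) with Consecutive⇒nth xs c
  ... | k , k<n , eq₁ , eq₂ = suc k , s≤s k<n , eq₁ , eq₂

  nth⇒Consecutive : ∀ (xs : List A) k → suc k < length xs
    → Consecutive (nth d xs k) (nth d xs (suc k)) xs
  nth⇒Consecutive (a ∷ b ∷ xs) zero    _         = here₂
  nth⇒Consecutive (a ∷ xs)     (suc k) (s≤s k<n) = there₂ (nth⇒Consecutive xs k k<n)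

  nth-++ˡ : ∀ (xs ys : List A) k → k < length xs → nth d (xs ++ ys) k ≡ nth d xs k
  nth-++ˡ (x ∷ xs) ys zero    _         = refl
  nth-++ˡ (x ∷ xs) ys (suc k) (s≤s k<n) = nth-++ˡ xs ys k k<n

  nth-length : ∀ (xs : List A) y ys → nth d (xs ++ y ∷ ys) (length xs) ≡ y
  nth-length []       y ys = refl
  nth-length (x ∷ xs) y ys = nth-length xs y ys

AllEdges-nth : ∀ {R} (xs : List Cell) k → AllEdges R xs → suc k < length xs
  → R (nth (0 , 0) xs k) (nth (0 , 0) xs (suc k))
AllEdges-nth (a ∷ [])     k       _        (s≤s ())
AllEdges-nth (a ∷ b ∷ xs) zero    (r , _)  _         = r
AllEdges-nth (a ∷ b ∷ xs) (suc k) (_ , rs) (s≤s k<n) = AllEdges-nth (b ∷ xs) k rs k<n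

NoDup-++ : ∀ {A : Set} (xs ys : List A) → NoDup xs → NoDup ys → (∀ z → z ∈ xs → z ∈ ys → ⊥)
  → NoDup (xs ++ ys)
NoDup-++ []       ys _          ndys disjoint = ndys
NoDup-++ (x ∷ xs) ys (x∉ ∷ ndxs) ndys disjoint =
  (λ x∈ → Sum.[ x∉ , disjoint x (here refl) ] (∈-++⁻ xs x∈))
  ∷ NoDup-++ xs ys ndxs ndys (λ z z∈xs → disjoint z (there z∈xs))

NoDup-map : {A B : Set} (g : A → B) → (∀ a a′ → g a ≡ g a′ → a ≡ a′)
  → (xs : List A) → NoDup xs → NoDup (map g xs)
NoDup-map g g-inj []       []          = []
NoDup-map g g-inj (x ∷ xs) (x∉ ∷ ndxs) = gx∉ ∷ NoDup-map g g-inj xs ndxs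
  where
  gx∉ : g x ∉ map g xs
  gx∉ gx∈ with ∈-map⁻ g gx∈
  ... | a , a∈ , eq = x∉ (subst (_∈ xs) (sym (g-inj x a eq)) a∈)

NoDup-applyUpTo : {A : Set} (f : ℕ → A) → (∀ i j → f i ≡ f j → i ≡ j) → ∀ n → NoDup (applyUpTo f n)
NoDup-applyUpTo f f-inj zero    = []
NoDup-applyUpTo f f-inj (suc n) =
  f0∉ ∷ NoDup-applyUpTo (λ i → f (suc i)) (λ i j eq → suc-injective (f-inj (suc i) (suc j) eq)) n
  where
  f0∉ : f 0 ∉ applyUpTo (λ i → f (suc i)) n
  f0∉ f0∈ with ∈-applyUpTo⁻ (λ i → f (suc i)) f0∈
  ... | i , _ , eq with f-inj 0 (suc i) eq
  ... | ()

NoDup⇒length≤ : ∀ {A : Set} (xs ys : List A) → NoDup xs → (∀ z → z ∈ xs → z ∈ ys) → length xs ≤ length ys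
NoDup⇒length≤ []       ys _           _  = z≤n
NoDup⇒length≤ (x ∷ xs) ys (x∉ ∷ ndxs) xs⊆ys with ∈-∃++ (xs⊆ys x (here refl))
... | ys₁ , ys₂ , refl =
  subst (suc (length xs) ≤_) (sym length-split) (s≤s (NoDup⇒length≤ xs (ys₁ ++ ys₂) ndxs xs⊆ys₁ys₂))
  where
  length-split : length (ys₁ ++ x ∷ ys₂) ≡ suc (length (ys₁ ++ ys₂))
  length-split = trans (length-++ ys₁)
    (trans (+-suc (length ys₁) (length ys₂)) (cong suc (sym (length-++ ys₁))))
  xs⊆ys₁ys₂ : ∀ z → z ∈ xs → z ∈ ys₁ ++ ys₂
  xs⊆ys₁ys₂ z z∈xs with ∈-++⁻ ys₁ (xs⊆ys z (there z∈xs))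
  ... | inj₁ z∈ys₁        = ∈-++⁺ˡ z∈ys₁
  ... | inj₂ (here refl)  = ⊥-elim (x∉ z∈xs)
  ... | inj₂ (there z∈ys₂) = ∈-++⁺ʳ ys₁ z∈ys₂

concatUpTo : {A : Set} → (ℕ → List A) → ℕ → List A
concatUpTo f zero    = []
concatUpTo f (suc n) = f 0 ++ concatUpTo (λ i → f (suc i)) n

module _ {A : Set} where

  ∈-concatUpTo⁺ : ∀ (f : ℕ → List A) n i {z} → i < n → z ∈ f i → z ∈ concatUpTo f n
  ∈-concatUpTo⁺ f (suc n) zero    _         z∈ = ∈-++⁺ˡ z∈
  ∈-concatUpTo⁺ f (suc n) (suc i) (s≤s i<n) z∈ =
    ∈-++⁺ʳ (f 0) (∈-concatUpTo⁺ (λ i → f (suc i)) n i i<n z∈)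

  ∈-concatUpTo⁻ : ∀ (f : ℕ → List A) n {z} → z ∈ concatUpTo f n → ∃[ i ] (i < n × z ∈ f i)
  ∈-concatUpTo⁻ f (suc n) z∈ with ∈-++⁻ (f 0) z∈
  ... | inj₁ z∈f0 = 0 , s≤s z≤n , z∈f0
  ... | inj₂ z∈fs with ∈-concatUpTo⁻ (λ i → f (suc i)) n z∈fs
  ... | i , i<n , z∈fi = suc i , s≤s i<n , z∈fi

  NoDup-concatUpTo : ∀ (f : ℕ → List A) n → (∀ i → i < n → NoDup (f i))
    → (∀ i j z → i < n → j < n → z ∈ f i → z ∈ f j → i ≡ j) → NoDup (concatUpTo f n)
  NoDup-concatUpTo f zero    _  _        = []
  NoDup-concatUpTo f (suc n) nd disjoint =
    NoDup-++ (f 0) _ (nd 0 (s≤s z≤n))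
      (NoDup-concatUpTo (λ i → f (suc i)) n (λ i i<n → nd (suc i) (s≤s i<n))
        (λ i j z i<n j<n z∈i z∈j → suc-injective (disjoint (suc i) (suc j) z (s≤s i<n) (s≤s j<n) z∈i z∈j)))
      f0-disjoint
    where
    f0-disjoint : ∀ z → z ∈ f 0 → z ∈ concatUpTo (λ i → f (suc i)) n → ⊥
    f0-disjoint z z∈f0 z∈fs with ∈-concatUpTo⁻ (λ i → f (suc i)) n z∈fs
    ... | i , i<n , z∈fi with disjoint 0 (suc i) z (s≤s z≤n) (s≤s i<n) z∈f0 z∈fi
    ... | ()

  length-concatUpTo : ∀ (f : ℕ → List A) n k → (∀ i → length (f i) ≡ k) → length (concatUpTo f n) ≡ n * k
  length-concatUpTo f zero    k _   = refl
  length-concatUpTo f (suc n) k len =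
    trans (length-++ (f 0)) (cong₂ _+_ (len 0) (length-concatUpTo (λ i → f (suc i)) n k (λ i → len (suc i))))

  concatUpTo-cong : ∀ (f g : ℕ → List A) n → (∀ i → f i ≡ g i) → concatUpTo f n ≡ concatUpTo g n
  concatUpTo-cong f g zero    _   = refl
  concatUpTo-cong f g (suc n) f≗g =
    cong₂ _++_ (f≗g 0) (concatUpTo-cong (λ i → f (suc i)) (λ i → g (suc i)) n (λ i → f≗g (suc i)))

applyUpTo-cong : ∀ {A : Set} (f g : ℕ → A) n → (∀ i → i < n → f i ≡ g i) → applyUpTo f n ≡ applyUpTo g n
applyUpTo-cong f g zero    _   = refl
applyUpTo-cong f g (suc n) f≗g =
  cong₂ _∷_ (f≗g 0 (s≤s z≤n))
    (applyUpTo-cong (λ i → f (suc i)) (λ i → g (suc i)) n (λ i i<n → f≗g (suc i) (s≤s i<n)))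

AllEdges-join : ∀ {R} (xs : List Cell) y ys → AllEdges R (xs ++ [ y ]) → AllEdges R (y ∷ ys)
  → AllEdges R (xs ++ y ∷ ys)
AllEdges-join []            y ys _        r = r
AllEdges-join (x ∷ [])      y ys (r , _)  s = r , s
AllEdges-join (x ∷ x′ ∷ xs) y ys (r , rs) s = r , AllEdges-join (x′ ∷ xs) y ys rs s

AllEdges-map : ∀ {R R′} (g : Cell → Cell) → (∀ p q → R p q → R′ (g p) (g q))
  → ∀ xs → AllEdges R xs → AllEdges R′ (map g xs)
AllEdges-map g g-hom []           _        = tt
AllEdges-map g g-hom (p ∷ [])     _        = tt
AllEdges-map g g-hom (p ∷ q ∷ xs) (r , rs) = g-hom p q r , AllEdges-map g g-hom (q ∷ xs) rs

module _ {A : Set} where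

  Consecutive-split : ∀ {a b : A} xs y ys → Consecutive a b (xs ++ y ∷ ys)
    → Consecutive a b (xs ++ [ y ]) ⊎ Consecutive a b (y ∷ ys)
  Consecutive-split []            y ys c          = inj₂ c
  Consecutive-split (x ∷ [])      y ys here₂      = inj₁ here₂
  Consecutive-split (x ∷ [])      y ys (there₂ c) = inj₂ c
  Consecutive-split (x ∷ x′ ∷ xs) y ys here₂      = inj₁ here₂
  Consecutive-split (x ∷ x′ ∷ xs) y ys (there₂ c) =
    Sum.map₁ there₂ (Consecutive-split (x′ ∷ xs) y ys c)

  Consecutive-++ˡ : ∀ {a b : A} xs y ys → Consecutive a b (xs ++ [ y ]) → Consecutive a b (xs ++ y ∷ ys)
  Consecutive-++ˡ []            y ys (there₂ ())
  Consecutive-++ˡ (x ∷ [])      y ys here₂      = here₂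
  Consecutive-++ˡ (x ∷ x′ ∷ xs) y ys here₂      = here₂
  Consecutive-++ˡ (x ∷ xs)      y ys (there₂ c) = there₂ (Consecutive-++ˡ xs y ys c)

  Consecutive-++ʳ : ∀ {a b : A} xs y ys → Consecutive a b (y ∷ ys) → Consecutive a b (xs ++ y ∷ ys)
  Consecutive-++ʳ []       y ys c = c
  Consecutive-++ʳ (x ∷ xs) y ys c = there₂ (Consecutive-++ʳ xs y ys c)

  Consecutive-map⁺ : ∀ {B : Set} (g : A → B) {a b : A} xs → Consecutive a b xs
    → Consecutive (g a) (g b) (map g xs)
  Consecutive-map⁺ g (_ ∷ _ ∷ xs) here₂      = here₂
  Consecutive-map⁺ g (_ ∷ xs)     (there₂ c) = there₂ (Consecutive-map⁺ g xs c)

  Consecutive-map⁻ : ∀ {B : Set} (g : A → B) {a b : B} xs → Consecutive a b (map g xs)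
    → ∃[ o ] ∃[ o′ ] (Consecutive o o′ xs × g o ≡ a × g o′ ≡ b)
  Consecutive-map⁻ g (o ∷ o′ ∷ xs) here₂ = o , o′ , here₂ , refl , refl
  Consecutive-map⁻ g (o ∷ xs) (there₂ c) with Consecutive-map⁻ g xs c
  ... | p , p′ , c′ , eq₁ , eq₂ = p , p′ , there₂ c′ , eq₁ , eq₂

AllEdges-Consecutive : ∀ {R a b} xs → AllEdges R xs → Consecutive a b xs → R a b
AllEdges-Consecutive (_ ∷ _ ∷ xs) (r , _)  here₂      = r
AllEdges-Consecutive (_ ∷ x ∷ xs) (_ , rs) (there₂ c) = AllEdges-Consecutive (x ∷ xs) rs c

-- Counting straights along a walk

consecutiveWith : ∀ {A B : Set} → (A → A → B) → List A → List B
consecutiveWith h []          = []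
consecutiveWith h (p ∷ [])    = []
consecutiveWith h (p ∷ q ∷ r) = h p q ∷ consecutiveWith h (q ∷ r)

straightness : Bool → Bool → ℕ
straightness h₁ h₂ = if (h₁ ∧ h₂) ∨ (not h₁ ∧ not h₂) then 1 else 0

-- Straights at the inner cells of a walk whose edges have the given orientations
-- (true = horizontal).
innerStraights : List Bool → ℕ
innerStraights []          = 0
innerStraights (a ∷ [])    = 0
innerStraights (a ∷ b ∷ r) = straightness a b + innerStraights (b ∷ r)

sumUpTo : (ℕ → ℕ) → ℕ → ℕ
sumUpTo f zero    = 0
sumUpTo f (suc n) = f 0 + sumUpTo (λ i → f (suc i)) n

sumUpTo-single : ∀ f n i₀ → i₀ < n → (∀ i → i < n → i ≢ i₀ → f i ≡ 0) → sumUpTo f n ≡ f i₀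
sumUpTo-single f (suc n) zero _ f≡0 =
  trans (cong (f 0 +_) (sumUpTo-zero (λ i → f (suc i)) n (λ i i<n → f≡0 (suc i) (s≤s i<n) λ ())))
        (+-identityʳ (f 0))
  where
  sumUpTo-zero : ∀ g n → (∀ i → i < n → g i ≡ 0) → sumUpTo g n ≡ 0
  sumUpTo-zero g zero    _   = refl
  sumUpTo-zero g (suc n) g≡0 =
    cong₂ _+_ (g≡0 0 (s≤s z≤n)) (sumUpTo-zero (λ i → g (suc i)) n (λ i i<n → g≡0 (suc i) (s≤s i<n)))
sumUpTo-single f (suc n) (suc i₀) (s≤s i₀<n) f≡0 =
  trans (cong (_+ sumUpTo (λ i → f (suc i)) n) (f≡0 0 (s≤s z≤n) λ ()))
        (sumUpTo-single (λ i → f (suc i)) n i₀ i₀<n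
          (λ i i<n i≢i₀ → f≡0 (suc i) (s≤s i<n) (λ eq → i≢i₀ (suc-injective eq))))

consecutiveWith-split : ∀ {A B : Set} (h : A → A → B) xs y ys
  → consecutiveWith h (xs ++ y ∷ ys) ≡ consecutiveWith h (xs ++ [ y ]) ++ consecutiveWith h (y ∷ ys)
consecutiveWith-split h []            y ys = refl
consecutiveWith-split h (x ∷ [])      y ys = refl
consecutiveWith-split h (x ∷ x′ ∷ xs) y ys = cong (h x x′ ∷_) (consecutiveWith-split h (x′ ∷ xs) y ys)

innerStraights-split : ∀ xs y ys
  → innerStraights (xs ++ y ∷ ys) ≡ innerStraights (xs ++ [ y ]) + innerStraights (y ∷ ys)
innerStraights-split []            y ys = refl
innerStraights-split (x ∷ [])      y ys = cong (_+ innerStraights (y ∷ ys)) (sym (+-identityʳ (straightness x y)))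
innerStraights-split (x ∷ x′ ∷ xs) y ys =
  trans (cong (straightness x x′ +_) (innerStraights-split (x′ ∷ xs) y ys))
        (sym (+-assoc (straightness x x′) _ _))

applyUpTo-consecutiveWith : ∀ {A B : Set} (d : A) (h : A → A → B) w ws
  → applyUpTo (λ i → h (nth d (w ∷ ws) i) (nth d (w ∷ ws) (suc i))) (length ws) ≡ consecutiveWith h (w ∷ ws)
applyUpTo-consecutiveWith d h w []        = refl
applyUpTo-consecutiveWith d h w (w′ ∷ ws) = cong (h w w′ ∷_) (applyUpTo-consecutiveWith d h w′ ws)

sum-straightness : ∀ (e : ℕ → Bool) n
  → sum (applyUpTo (λ i → straightness (e i) (e (suc i))) n) ≡ innerStraights (applyUpTo e (suc n))
sum-straightness e zero    = refl
sum-straightness e (suc n) = cong (straightness (e 0) (e 1) +_) (sum-straightness (λ i → e (suc i)) n)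

module _ {A : Set} where

  chain : (ℕ → A) → (ℕ → List A) → ℕ → List A
  chain hd R n = concatUpTo (λ i → hd i ∷ R i) n ++ [ hd n ]

  link : (ℕ → A) → (ℕ → List A) → ℕ → List A
  link hd R i = hd i ∷ R i ++ [ hd (suc i) ]

  chain-suc : ∀ hd R n → chain hd R (suc n) ≡ hd 0 ∷ R 0 ++ chain (λ i → hd (suc i)) (λ i → R (suc i)) n
  chain-suc hd R n = cong (hd 0 ∷_) (++-assoc (R 0) _ _)

  chain-head : ∀ hd R n → ∃[ t ] (chain hd R n ≡ hd 0 ∷ t)
  chain-head hd R zero    = [] , refl
  chain-head hd R (suc n) = _ , chain-suc hd R n

  chain-unfold : ∀ hd R n → ∃[ t ] (chain (λ i → hd (suc i)) (λ i → R (suc i)) n ≡ hd 1 ∷ t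
                                      × chain hd R (suc n) ≡ hd 0 ∷ R 0 ++ hd 1 ∷ t)
  chain-unfold hd R n with chain-head (λ i → hd (suc i)) (λ i → R (suc i)) n
  ... | t , eq = t , eq , trans (chain-suc hd R n) (cong (λ z → hd 0 ∷ R 0 ++ z) eq)

  Consecutive-chain⁻ : ∀ hd R n {a b} → Consecutive a b (chain hd R n)
    → ∃[ i ] (i < n × Consecutive a b (link hd R i))
  Consecutive-chain⁻ hd R zero    (there₂ ())
  Consecutive-chain⁻ hd R (suc n) {a} {b} c with chain-unfold hd R n
  ... | t , eqₜ , eq with Consecutive-split (hd 0 ∷ R 0) (hd 1) t (subst (Consecutive a b) eq c)
  ... | inj₁ c₀ = 0 , s≤s z≤n , c₀
  ... | inj₂ cₜ with Consecutive-chain⁻ (λ i → hd (suc i)) (λ i → R (suc i)) n (subst (Consecutive a b) (sym eqₜ) cₜ)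
  ... | i , i<n , cᵢ = suc i , s≤s i<n , cᵢ

  Consecutive-chain⁺ : ∀ hd R n i {a b} → i < n → Consecutive a b (link hd R i)
    → Consecutive a b (chain hd R n)
  Consecutive-chain⁺ hd R (suc n) i {a} {b} i<n c with chain-unfold hd R n
  ... | t , eqₜ , eq = subst (Consecutive a b) (sym eq) (go i i<n c)
    where
    go : ∀ i → i < suc n → Consecutive a b (link hd R i) → Consecutive a b (hd 0 ∷ R 0 ++ hd 1 ∷ t)
    go zero    _         c = Consecutive-++ˡ (hd 0 ∷ R 0) (hd 1) t c
    go (suc i) (s≤s i<n) c = Consecutive-++ʳ (hd 0 ∷ R 0) (hd 1) t
      (subst (Consecutive a b) eqₜ (Consecutive-chain⁺ (λ i → hd (suc i)) (λ i → R (suc i)) n i i<n c))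

  consecutiveWith-chain : ∀ {B : Set} (h : A → A → B) hd R n
    → consecutiveWith h (chain hd R n) ≡ concatUpTo (λ i → consecutiveWith h (link hd R i)) n
  consecutiveWith-chain h hd R zero    = refl
  consecutiveWith-chain h hd R (suc n) with chain-unfold hd R n
  ... | t , eqₜ , eq = begin
    consecutiveWith h (chain hd R (suc n))
      ≡⟨ cong (consecutiveWith h) eq ⟩
    consecutiveWith h (hd 0 ∷ R 0 ++ hd 1 ∷ t)
      ≡⟨ consecutiveWith-split h (hd 0 ∷ R 0) (hd 1) t ⟩
    consecutiveWith h (link hd R 0) ++ consecutiveWith h (hd 1 ∷ t)
      ≡⟨ cong (λ z → consecutiveWith h (link hd R 0) ++ consecutiveWith h z) (sym eqₜ) ⟩
    consecutiveWith h (link hd R 0) ++ consecutiveWith h (chain (λ i → hd (suc i)) (λ i → R (suc i)) n)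
      ≡⟨ cong (consecutiveWith h (link hd R 0) ++_) (consecutiveWith-chain h (λ i → hd (suc i)) (λ i → R (suc i)) n) ⟩
    concatUpTo (λ i → consecutiveWith h (link hd R i)) (suc n) ∎
    where open ≡-Reasoning

AllEdges-chain : ∀ {R} (hd : ℕ → Cell) (Q : ℕ → List Cell) n
  → (∀ i → i < n → AllEdges R (link hd Q i)) → AllEdges R (chain hd Q n)
AllEdges-chain hd Q zero    _ = tt
AllEdges-chain {R} hd Q (suc n) links with chain-unfold hd Q n
... | t , eqₜ , eq = subst (AllEdges R) (sym eq)
  (AllEdges-join (hd 0 ∷ Q 0) (hd 1) t (links 0 (s≤s z≤n))
    (subst (AllEdges R) eqₜ (AllEdges-chain (λ i → hd (suc i)) (λ i → Q (suc i)) n (λ i i<n → links (suc i) (s≤s i<n)))))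

lastOr : {A : Set} → A → List A → A
lastOr a []       = a
lastOr a (b ∷ bs) = lastOr b bs

innerStraights-∷ʳ : ∀ b bs w
  → innerStraights ((b ∷ bs) ++ [ w ]) ≡ innerStraights (b ∷ bs) + straightness (lastOr b bs) w
innerStraights-∷ʳ b []       w = +-identityʳ (straightness b w)
innerStraights-∷ʳ b (c ∷ bs) w =
  trans (cong (straightness b c +_) (innerStraights-∷ʳ c bs w))
        (sym (+-assoc (straightness b c) (innerStraights (c ∷ bs)) _))

innerStraights-chain : ∀ (e : ℕ → Bool) (Y : ℕ → List Bool) n → (∀ i → lastOr (e i) (Y i) ≡ e i)
  → innerStraights (chain e Y n)
    ≡ sumUpTo (λ i → innerStraights (e i ∷ Y i)) n + innerStraights (applyUpTo e n ++ [ e n ])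
innerStraights-chain e Y zero    _    = refl
innerStraights-chain e Y (suc n) ends with chain-unfold e Y n
... | t , eqₜ , eq = begin
    innerStraights (chain e Y (suc n))
      ≡⟨ cong innerStraights eq ⟩
    innerStraights ((e 0 ∷ Y 0) ++ e 1 ∷ t)
      ≡⟨ innerStraights-split (e 0 ∷ Y 0) (e 1) t ⟩
    innerStraights ((e 0 ∷ Y 0) ++ [ e 1 ]) + innerStraights (e 1 ∷ t)
      ≡⟨ cong₂ _+_ (trans (innerStraights-∷ʳ (e 0) (Y 0) (e 1)) (cong (λ b → a + straightness b (e 1)) (ends 0)))
                   (trans (cong innerStraights (sym eqₜ))
                          (innerStraights-chain (λ i → e (suc i)) (λ i → Y (suc i)) n (λ i → ends (suc i)))) ⟩
    (a + s) + (c + d)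
      ≡⟨ +-*-Solver.solve 4 (λ a s c d → (a :+ s) :+ (c :+ d) := (a :+ c) :+ (s :+ d)) refl a s c d ⟩
    (a + c) + (s + d)
      ≡⟨ cong ((a + c) +_) (sym (walk-suc n)) ⟩
    sumUpTo (λ i → innerStraights (e i ∷ Y i)) (suc n) + innerStraights (applyUpTo e (suc n) ++ [ e (suc n) ]) ∎
  where
  open ≡-Reasoning
  open +-*-Solver using (_:+_; _:=_)
  a = innerStraights (e 0 ∷ Y 0)
  s = straightness (e 0) (e 1)
  c = sumUpTo (λ i → innerStraights (e (suc i) ∷ Y (suc i))) n
  d = innerStraights (applyUpTo (λ i → e (suc i)) n ++ [ e (suc n) ])
  walk-suc : ∀ k → innerStraights (applyUpTo e (suc k) ++ [ e (suc k) ])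
                   ≡ straightness (e 0) (e 1) + innerStraights (applyUpTo (λ i → e (suc i)) k ++ [ e (suc k) ])
  walk-suc zero    = refl
  walk-suc (suc k) = refl

orientation : ∀ {m n} → HamCycle m n → ℕ → Bool
orientation C i = isHorizontal (cell C i) (cell C (suc i))

numStraights≡innerStraights : ∀ {m n} (C : HamCycle m n)
  → numStraights C ≡ innerStraights (applyUpTo (orientation C) (m * n) ++ [ orientation C 0 ])
numStraights≡innerStraights {m} {n} C = begin
  numStraights C
    ≡⟨ cong sum (map-upTo (λ i → if isStraightAt C (suc i) then 1 else 0) (m * n)) ⟩
  sum (applyUpTo (λ i → straightness (orientation C i) (orientation C (suc i))) (m * n))
    ≡⟨ sum-straightness (orientation C) (m * n) ⟩
  innerStraights (applyUpTo (orientation C) (suc (m * n)))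
    ≡⟨ cong innerStraights (sym (applyUpTo-∷ʳ (orientation C) (m * n))) ⟩
  innerStraights (applyUpTo (orientation C) (m * n) ++ [ orientation C (m * n) ])
    ≡⟨ cong (λ b → innerStraights (applyUpTo (orientation C) (m * n) ++ [ b ])) orientation-period ⟩
  innerStraights (applyUpTo (orientation C) (m * n) ++ [ orientation C 0 ]) ∎
  where
  open ≡-Reasoning
  orientation-period : orientation C (m * n) ≡ orientation C 0
  orientation-period = cong₂ isHorizontal (periodic C 0) (periodic C 1)

EdgeAt : ∀ {m n} → HamCycle m n → ℕ → Cell → Cell → Set
EdgeAt C i p q = (cell C i ≡ p × cell C (suc i) ≡ q) ⊎ (cell C i ≡ q × cell C (suc i) ≡ p)

EdgeAt-swap : ∀ {m n} {C : HamCycle m n} {i p q} → EdgeAt C i p q → EdgeAt C i q p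
EdgeAt-swap (inj₁ e) = inj₂ e
EdgeAt-swap (inj₂ e) = inj₁ e

UsesEdge-swap : ∀ {m n} {C : HamCycle m n} {p q} → UsesEdge C p q → UsesEdge C q p
UsesEdge-swap {C = C} (i , e) = i , EdgeAt-swap {C = C} e

Adj-swap : ∀ p q → Adj p q → Adj q p
Adj-swap (a , b) (c , d) adj = trans (cong₂ _+_ (∣-∣-comm c a) (∣-∣-comm d b)) adj

UsesEdge⇒Adj : ∀ {m n} (C : HamCycle m n) {p q} → UsesEdge C p q → Adj p q
UsesEdge⇒Adj C (i , inj₁ (refl , refl)) = adjacent C i
UsesEdge⇒Adj C (i , inj₂ (refl , refl)) = Adj-swap (cell C i) (cell C (suc i)) (adjacent C i)

module Period {m n : ℕ} (C : HamCycle m n) (K : ℕ) (mn≡N : m * n ≡ suc K) where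

  N : ℕ
  N = suc K

  cell-+* : ∀ j q → cell C (j + q * N) ≡ cell C j
  cell-+* j zero    = cong (cell C) (+-identityʳ j)
  cell-+* j (suc q) = begin
    cell C (j + (N + q * N)) ≡⟨ cong (cell C) (trans (cong (j +_) (+-comm N (q * N))) (sym (+-assoc j (q * N) N))) ⟩
    cell C (j + q * N + N)   ≡⟨ subst (λ M → cell C (j + q * N + M) ≡ cell C (j + q * N)) mn≡N (periodic C (j + q * N)) ⟩
    cell C (j + q * N)       ≡⟨ cell-+* j q ⟩
    cell C j                 ∎
    where open ≡-Reasoning

  cell-% : ∀ j → cell C j ≡ cell C (j % N)
  cell-% j = trans (cong (cell C) (m≡m%n+[m/n]*n j N)) (cell-+* (j % N) (j / N))

  cell-suc-% : ∀ j → cell C (suc j) ≡ cell C (suc (j % N))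
  cell-suc-% j = trans (cong (cell C) (cong suc (m≡m%n+[m/n]*n j N))) (cell-+* (suc (j % N)) (j / N))

  cell-N : cell C N ≡ cell C 0
  cell-N = subst (λ M → cell C M ≡ cell C 0) mn≡N (periodic C 0)

  cell-injective : ∀ i j → i < N → j < N → cell C i ≡ cell C j → i ≡ j
  cell-injective i j i<N j<N = injective C i j (subst (i <_) (sym mn≡N) i<N) (subst (j <_) (sym mn≡N) j<N)

  UsesEdge⇒EdgeAt : ∀ {p q} → UsesEdge C p q → ∃[ i ] (i < N × EdgeAt C i p q)
  UsesEdge⇒EdgeAt (j , e) = j % N , m%n<n j N , Sum.map reduce reduce e
    where
    reduce : ∀ {p q} → cell C j ≡ p × cell C (suc j) ≡ q → cell C (j % N) ≡ p × cell C (suc (j % N)) ≡ q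
    reduce (eq₁ , eq₂) = trans (sym (cell-% j)) eq₁ , trans (sym (cell-suc-% j)) eq₂

  -- Traversing an edge in both directions, at steps i and j, would force i + 2 ≡ j ≡ i - 2 (mod N).
  private
    no-backtrack : ∀ i j → 2 < N → i < N → j < N → cell C i ≡ cell C (suc j) → cell C (suc i) ≡ cell C j → ⊥
    no-backtrack i j 2<N i<N j<N eq₁ eq₂ with suc j <? N
    ... | yes 1+j<N with cell-injective i (suc j) i<N 1+j<N eq₁
    ...   | refl with suc (suc j) <? N
    ...     | yes 2+j<N with cell-injective (suc (suc j)) j 2+j<N j<N eq₂
    ...       | ()
    no-backtrack i j 2<N i<N j<N eq₁ eq₂ | yes 1+j<N | refl | no 2+j≮N with ≤-antisym (≮⇒≥ 2+j≮N) 1+j<N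
    ...       | refl with cell-injective 0 j (s≤s z≤n) j<N (trans (sym cell-N) eq₂)
    ...         | refl = <-irrefl refl 2<N
    no-backtrack i j 2<N i<N j<N eq₁ eq₂ | no 1+j≮N with ≤-antisym (≮⇒≥ 1+j≮N) j<N
    ... | refl with cell-injective i 0 i<N (s≤s z≤n) (trans eq₁ cell-N)
    ...   | refl with cell-injective 1 j (<-trans (s≤s (s≤s z≤n)) 2<N) j<N eq₂
    ...     | refl = <-irrefl refl 2<N

  EdgeAt-unique : ∀ i j {p q} → 2 < N → i < N → j < N → EdgeAt C i p q → EdgeAt C j p q → i ≡ j
  EdgeAt-unique i j 2<N i<N j<N (inj₁ (a , b)) (inj₁ (c , d)) = cell-injective i j i<N j<N (trans a (sym c))
  EdgeAt-unique i j 2<N i<N j<N (inj₂ (a , b)) (inj₂ (c , d)) = cell-injective i j i<N j<N (trans a (sym c))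
  EdgeAt-unique i j 2<N i<N j<N (inj₁ (a , b)) (inj₂ (c , d)) =
    ⊥-elim (no-backtrack i j 2<N i<N j<N (trans a (sym d)) (trans b (sym c)))
  EdgeAt-unique i j 2<N i<N j<N (inj₂ (a , b)) (inj₁ (c , d)) =
    ⊥-elim (no-backtrack i j 2<N i<N j<N (trans a (sym d)) (trans b (sym c)))

gridCells : ℕ → ℕ → List Cell
gridCells M n = concatUpTo (λ a → applyUpTo (λ b → (suc a , suc b)) n) M

gridCells⁻ : ∀ M n z → z ∈ gridCells M n → InGrid M n z
gridCells⁻ M n z z∈ with ∈-concatUpTo⁻ (λ a → applyUpTo (λ b → (suc a , suc b)) n) M z∈
... | a , a<M , z∈col with ∈-applyUpTo⁻ (λ b → (suc a , suc b)) z∈col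
... | b , b<n , refl = (s≤s z≤n , a<M) , (s≤s z≤n , b<n)

gridCells⁺ : ∀ M n z → InGrid M n z → z ∈ gridCells M n
gridCells⁺ M n (suc a , suc b) ((_ , a<M) , (_ , b<n)) =
  ∈-concatUpTo⁺ (λ a → applyUpTo (λ b → (suc a , suc b)) n) M a a<M (∈-applyUpTo⁺ (λ b → (suc a , suc b)) b<n)

gridCells-noDup : ∀ M n → NoDup (gridCells M n)
gridCells-noDup M n = NoDup-concatUpTo _ M
  (λ a _ → NoDup-applyUpTo (λ b → (suc a , suc b)) (λ i j eq → suc-injective (cong proj₂ eq)) n)
  (λ i j z _ _ → same-column i j z)
  where
  same-column : ∀ i j z → z ∈ applyUpTo (λ b → (suc i , suc b)) n → z ∈ applyUpTo (λ b → (suc j , suc b)) n → i ≡ j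
  same-column i j z z∈i z∈j with ∈-applyUpTo⁻ (λ b → (suc i , suc b)) z∈i | ∈-applyUpTo⁻ (λ b → (suc j , suc b)) z∈j
  ... | _ , _ , refl | _ , _ , eq = suc-injective (cong proj₁ eq)

length-gridCells : ∀ M n → length (gridCells M n) ≡ M * n
length-gridCells M n = length-concatUpTo _ M n (λ a → length-applyUpTo _ n)

length-≡-gridSize : ∀ M n (zs : List Cell) → NoDup zs → (∀ z → z ∈ zs → InGrid M n z)
  → (∀ z → InGrid M n z → z ∈ zs) → length zs ≡ M * n
length-≡-gridSize M n zs noDup ⊆grid grid⊆ = ≤-antisym
  (subst (length zs ≤_) (length-gridCells M n)
    (NoDup⇒length≤ zs (gridCells M n) noDup (λ z z∈ → gridCells⁺ M n z (⊆grid z z∈))))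
  (subst (_≤ length zs) (length-gridCells M n)
    (NoDup⇒length≤ (gridCells M n) zs (gridCells-noDup M n) (λ z z∈ → grid⊆ z (gridCells⁻ M n z z∈))))

module CycleFromList (M n : ℕ) (z₀ : Cell) (zs : List Cell)
  (size : M * n ≡ suc (length zs))
  (noDup : NoDup (z₀ ∷ zs))
  (⊆grid : ∀ z → z ∈ z₀ ∷ zs → InGrid M n z)
  (grid⊆ : ∀ z → InGrid M n z → z ∈ z₀ ∷ zs)
  (adj : AllEdges Adj ((z₀ ∷ zs) ++ [ z₀ ])) where

  N : ℕ
  N = suc (length zs)

  closed : List Cell
  closed = (z₀ ∷ zs) ++ [ z₀ ]

  d₀ : Cell
  d₀ = (0 , 0)

  length-closed : length closed ≡ suc N
  length-closed = trans (length-++ (z₀ ∷ zs)) (+-comm N 1)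

  cellAt : ℕ → Cell
  cellAt j = nth d₀ (z₀ ∷ zs) (j % N)

  %-small : ∀ i → i < N → i % N ≡ i
  %-small i = m<n⇒m%n≡m

  suc-% : ∀ k → k < N → (suc k < N × suc k % N ≡ suc k) ⊎ (suc k ≡ N × suc k % N ≡ 0)
  suc-% k k<N with suc k <? N
  ... | yes 1+k<N = inj₁ (1+k<N , m<n⇒m%n≡m 1+k<N)
  ... | no 1+k≮N with ≤-antisym (≮⇒≥ 1+k≮N) k<N
  ... | eq = inj₂ (sym eq , trans (cong (_% N) (sym eq)) (n%n≡0 N))

  cellAt-closed : ∀ i → cellAt i ≡ nth d₀ closed (i % N) × cellAt (suc i) ≡ nth d₀ closed (suc (i % N))
  cellAt-closed i = sym (nth-++ˡ d₀ (z₀ ∷ zs) [ z₀ ] k k<N) , next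
    where
    k = i % N
    k<N = m%n<n i N
    suc-i-% : suc i % N ≡ suc k % N
    suc-i-% = trans (cong (λ z → suc z % N) (m≡m%n+[m/n]*n i N)) ([m+kn]%n≡m%n (suc k) (i / N) N)
    next : cellAt (suc i) ≡ nth d₀ closed (suc k)
    next with suc-% k k<N
    ... | inj₁ (1+k<N , eq) =
      trans (cong (nth d₀ (z₀ ∷ zs)) (trans suc-i-% eq)) (sym (nth-++ˡ d₀ (z₀ ∷ zs) [ z₀ ] (suc k) 1+k<N))
    ... | inj₂ (eq₁ , eq₂) =
      trans (cong (nth d₀ (z₀ ∷ zs)) (trans suc-i-% eq₂))
            (sym (subst (λ z → nth d₀ closed z ≡ z₀) (sym eq₁) (nth-length d₀ (z₀ ∷ zs) z₀ [])))

  cycle : HamCycle M n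
  cycle = record
    { cell       = cellAt
    ; periodic   = λ i → cong (nth d₀ (z₀ ∷ zs)) (trans (cong (λ z → (i + z) % N) size) ([m+n]%n≡m%n i N))
    ; inGrid     = λ i → ⊆grid _ (nth-∈ d₀ (z₀ ∷ zs) (i % N) (m%n<n i N))
    ; injective  = λ i j i< j< eq →
        let i<N = subst (i <_) size i< ; j<N = subst (j <_) size j< in
        trans (sym (%-small i i<N))
          (trans (nth-injective d₀ (z₀ ∷ zs) noDup (i % N) (j % N) (m%n<n i N) (m%n<n j N) eq) (%-small j j<N))
    ; surjective = λ z z∈grid → let (k , k<N , eq) = ∈⇒nth d₀ (z₀ ∷ zs) (grid⊆ z z∈grid) in
        k , subst (k <_) (sym size) k<N , trans (cong (nth d₀ (z₀ ∷ zs)) (%-small k k<N)) eq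
    ; adjacent   = λ i → let (eq₁ , eq₂) = cellAt-closed i in
        subst₂ Adj (sym eq₁) (sym eq₂)
          (AllEdges-nth closed (i % N) adj (subst (suc (i % N) <_) (sym length-closed) (s≤s (m%n<n i N))))
    }

  Consecutive⇒UsesEdge : ∀ {a b} → Consecutive a b closed → UsesEdge cycle a b
  Consecutive⇒UsesEdge c with Consecutive⇒nth d₀ closed c
  ... | k , k<N+1 , eq₁ , eq₂ =
    k , inj₁ ( trans (proj₁ (cellAt-closed k)) (trans (cong (nth d₀ closed) (%-small k k<N)) eq₁)
             , trans (proj₂ (cellAt-closed k)) (trans (cong (λ z → nth d₀ closed (suc z)) (%-small k k<N)) eq₂))
    where
    k<N : k < N
    k<N = ≤-pred (subst (suc k <_) length-closed k<N+1)

  step-Consecutive : ∀ i → Consecutive (cellAt i) (cellAt (suc i)) closed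
  step-Consecutive i with cellAt-closed i
  ... | eq₁ , eq₂ rewrite eq₁ | eq₂ =
    nth⇒Consecutive d₀ closed (i % N) (subst (suc (i % N) <_) (sym length-closed) (s≤s (m%n<n i N)))

  orientations : applyUpTo (orientation cycle) N ≡ consecutiveWith isHorizontal closed
  orientations = trans
    (applyUpTo-cong (orientation cycle) _ N (λ i i<N → cong₂ isHorizontal
      (trans (proj₁ (cellAt-closed i)) (cong (nth d₀ closed) (%-small i i<N)))
      (trans (proj₂ (cellAt-closed i)) (cong (λ z → nth d₀ closed (suc z)) (%-small i i<N)))))
    (subst (λ k → applyUpTo (λ i → isHorizontal (nth d₀ closed i) (nth d₀ closed (suc i))) k
                  ≡ consecutiveWith isHorizontal closed)
           (trans (length-++ zs) (+-comm (length zs) 1))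
           (applyUpTo-consecutiveWith d₀ isHorizontal z₀ (zs ++ [ z₀ ])))

  numStraights-cycle : numStraights cycle
    ≡ innerStraights (consecutiveWith isHorizontal closed ++ [ orientation cycle 0 ])
  numStraights-cycle = trans (numStraights≡innerStraights cycle)
    (cong innerStraights (cong (_++ [ orientation cycle 0 ]) (trans (cong (applyUpTo (orientation cycle)) size) orientations)))

_≟ᶜ_ : (p q : Cell) → Dec (p ≡ q)
_≟ᶜ_ = ≡-dec _≟_ _≟_

open DecMembership _≟ᶜ_ using (_∈?_)

noDup? : (xs : List Cell) → Dec (NoDup xs)
noDup? []       = yes []
noDup? (z ∷ xs) with z ∈? xs | noDup? xs
... | no z∉ | yes nd = yes (z∉ ∷ nd)
... | yes z∈ | _     = no λ { (z∉ ∷ _) → z∉ z∈ }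
... | _     | no ¬nd = no λ { (_ ∷ nd) → ¬nd nd }

allEdges? : ∀ {R} → (∀ p q → Dec (R p q)) → (xs : List Cell) → Dec (AllEdges R xs)
allEdges? R? []           = yes tt
allEdges? R? (p ∷ [])     = yes tt
allEdges? R? (p ∷ q ∷ xs) = R? p q ×-dec allEdges? R? (q ∷ xs)

adj? : ∀ p q → Dec (Adj p q)
adj? (a , b) (c , d) = (∣ a - c ∣ + ∣ b - d ∣) ≟ 1

consecutive? : ∀ a b (xs : List Cell) → Dec (Consecutive a b xs)
consecutive? a b []           = no λ ()
consecutive? a b (p ∷ [])     = no λ { (there₂ ()) }
consecutive? a b (p ∷ q ∷ xs) with a ≟ᶜ p | b ≟ᶜ q | consecutive? a b (q ∷ xs)
... | yes refl | yes refl | _       = yes here₂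
... | _        | _        | yes c   = yes (there₂ c)
... | no a≢p   | _        | no ¬c   = no λ { here₂ → a≢p refl ; (there₂ c) → ¬c c }
... | yes _    | no b≢q   | no ¬c   = no λ { here₂ → b≢q refl ; (there₂ c) → ¬c c }

-- A gadget is a path through a block of the six new columns, in local coordinates:
-- columns 1 … 6, rows 0 … height - 1; it is entered from column 0 and left to
-- column 7, both in row entryRow.  A zigzag fills the two rows of one pair; an
-- extended gadget fills two pairs, the empty one lying below or above the entry.

data Gadget : Set where
  zigzag-odd zigzag-even extended-below extended-above : Gadget

gadgetPath : Gadget → List Cell
gadgetPath zigzag-odd =
  (1 , 0) ∷ (1 , 1) ∷ (2 , 1) ∷ (2 , 0) ∷ (3 , 0) ∷ (3 , 1) ∷ (4 , 1) ∷ (4 , 0) ∷ (5 , 0) ∷ (5 , 1) ∷ (6 , 1) ∷ (6 , 0) ∷ []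
gadgetPath zigzag-even =
  (1 , 1) ∷ (1 , 0) ∷ (2 , 0) ∷ (2 , 1) ∷ (3 , 1) ∷ (3 , 0) ∷ (4 , 0) ∷ (4 , 1) ∷ (5 , 1) ∷ (5 , 0) ∷ (6 , 0) ∷ (6 , 1) ∷ []
gadgetPath extended-below =
  (1 , 2) ∷ (1 , 3) ∷ (2 , 3) ∷ (3 , 3) ∷ (3 , 2) ∷ (2 , 2) ∷ (2 , 1) ∷ (1 , 1) ∷ (1 , 0) ∷ (2 , 0) ∷ (3 , 0) ∷ (3 , 1)
  ∷ (4 , 1) ∷ (4 , 0) ∷ (5 , 0) ∷ (6 , 0) ∷ (6 , 1) ∷ (5 , 1) ∷ (5 , 2) ∷ (4 , 2) ∷ (4 , 3) ∷ (5 , 3) ∷ (6 , 3) ∷ (6 , 2) ∷ []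
gadgetPath extended-above =
  (1 , 1) ∷ (1 , 0) ∷ (2 , 0) ∷ (3 , 0) ∷ (3 , 1) ∷ (2 , 1) ∷ (2 , 2) ∷ (1 , 2) ∷ (1 , 3) ∷ (2 , 3) ∷ (3 , 3) ∷ (3 , 2)
  ∷ (4 , 2) ∷ (4 , 3) ∷ (5 , 3) ∷ (6 , 3) ∷ (6 , 2) ∷ (5 , 2) ∷ (5 , 1) ∷ (4 , 1) ∷ (4 , 0) ∷ (5 , 0) ∷ (6 , 0) ∷ (6 , 1) ∷ []

entryRow : Gadget → ℕ
entryRow zigzag-odd     = 0
entryRow zigzag-even    = 1
entryRow extended-below = 2
entryRow extended-above = 1

height : Gadget → ℕ
height zigzag-odd     = 2
height zigzag-even    = 2
height extended-below = 4
height extended-above = 4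

gadgetStraights : Gadget → ℕ
gadgetStraights zigzag-odd     = 0
gadgetStraights zigzag-even    = 0
gadgetStraights extended-below = 4
gadgetStraights extended-above = 4

data Traversal : Set where
  rightward leftward : Traversal

gadgetRun : Gadget → Traversal → List Cell
gadgetRun g rightward = gadgetPath g
gadgetRun g leftward  = reverse (gadgetPath g)

gadgetRun⊆gadgetPath : ∀ g t {o} → o ∈ gadgetRun g t → o ∈ gadgetPath g
gadgetRun⊆gadgetPath g rightward o∈ = o∈
gadgetRun⊆gadgetPath g leftward  o∈ = reverse⁻ o∈

gadgetPath⊆gadgetRun : ∀ g t {o} → o ∈ gadgetPath g → o ∈ gadgetRun g t
gadgetPath⊆gadgetRun g rightward o∈ = o∈
gadgetPath⊆gadgetRun g leftward  o∈ = reverse⁺ o∈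

entryColumn exitColumn : Traversal → ℕ
entryColumn rightward = 0
entryColumn leftward  = 7
exitColumn  rightward = 7
exitColumn  leftward  = 0

gadgetWalk : Gadget → Traversal → List Cell
gadgetWalk g t = (entryColumn t , entryRow g) ∷ gadgetRun g t ++ [ (exitColumn t , entryRow g) ]

rectangle : ℕ → List Cell
rectangle h = concatUpTo (λ k → applyUpTo (λ j → (suc k , j)) h) 6

InBlock : Gadget → Cell → Set
InBlock g (k , j) = (1 ≤ k × k ≤ 6) × j < height g

inBlock? : ∀ g p → Dec (InBlock g p)
inBlock? g (k , j) = ((1 ≤? k) ×-dec (k ≤? 6)) ×-dec (j <? height g)

EntryEdge : Gadget → Cell → Cell → Set
EntryEdge g (k , j) (k′ , j′) = (k ≡ 0 ⊎ k′ ≡ 0) → (j ≡ entryRow g × j′ ≡ entryRow g)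

entryEdge? : ∀ g p q → Dec (EntryEdge g p q)
entryEdge? g (k , j) (k′ , j′) = ((k ≟ 0) ⊎-dec (k′ ≟ 0)) →-dec ((j ≟ entryRow g) ×-dec (j′ ≟ entryRow g))

gadgetWalk-adjacent : ∀ g t → AllEdges Adj (gadgetWalk g t)
gadgetWalk-adjacent zigzag-odd     rightward = toWitness {a? = allEdges? adj? (gadgetWalk zigzag-odd rightward)} tt
gadgetWalk-adjacent zigzag-even    rightward = toWitness {a? = allEdges? adj? (gadgetWalk zigzag-even rightward)} tt
gadgetWalk-adjacent extended-below rightward = toWitness {a? = allEdges? adj? (gadgetWalk extended-below rightward)} tt
gadgetWalk-adjacent extended-above rightward = toWitness {a? = allEdges? adj? (gadgetWalk extended-above rightward)} tt
gadgetWalk-adjacent zigzag-odd     leftward  = toWitness {a? = allEdges? adj? (gadgetWalk zigzag-odd leftward)} tt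
gadgetWalk-adjacent zigzag-even    leftward  = toWitness {a? = allEdges? adj? (gadgetWalk zigzag-even leftward)} tt
gadgetWalk-adjacent extended-below leftward  = toWitness {a? = allEdges? adj? (gadgetWalk extended-below leftward)} tt
gadgetWalk-adjacent extended-above leftward  = toWitness {a? = allEdges? adj? (gadgetWalk extended-above leftward)} tt

gadgetWalk-entry : ∀ g t → AllEdges (EntryEdge g) (gadgetWalk g t)
gadgetWalk-entry zigzag-odd     rightward = toWitness {a? = allEdges? (entryEdge? zigzag-odd) (gadgetWalk zigzag-odd rightward)} tt
gadgetWalk-entry zigzag-even    rightward = toWitness {a? = allEdges? (entryEdge? zigzag-even) (gadgetWalk zigzag-even rightward)} tt
gadgetWalk-entry extended-below rightward = toWitness {a? = allEdges? (entryEdge? extended-below) (gadgetWalk extended-below rightward)} tt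
gadgetWalk-entry extended-above rightward = toWitness {a? = allEdges? (entryEdge? extended-above) (gadgetWalk extended-above rightward)} tt
gadgetWalk-entry zigzag-odd     leftward  = toWitness {a? = allEdges? (entryEdge? zigzag-odd) (gadgetWalk zigzag-odd leftward)} tt
gadgetWalk-entry zigzag-even    leftward  = toWitness {a? = allEdges? (entryEdge? zigzag-even) (gadgetWalk zigzag-even leftward)} tt
gadgetWalk-entry extended-below leftward  = toWitness {a? = allEdges? (entryEdge? extended-below) (gadgetWalk extended-below leftward)} tt
gadgetWalk-entry extended-above leftward  = toWitness {a? = allEdges? (entryEdge? extended-above) (gadgetWalk extended-above leftward)} tt

gadgetRun-noDup : ∀ g t → NoDup (gadgetRun g t)
gadgetRun-noDup zigzag-odd     rightward = toWitness {a? = noDup? (gadgetRun zigzag-odd rightward)} tt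
gadgetRun-noDup zigzag-even    rightward = toWitness {a? = noDup? (gadgetRun zigzag-even rightward)} tt
gadgetRun-noDup extended-below rightward = toWitness {a? = noDup? (gadgetRun extended-below rightward)} tt
gadgetRun-noDup extended-above rightward = toWitness {a? = noDup? (gadgetRun extended-above rightward)} tt
gadgetRun-noDup zigzag-odd     leftward  = toWitness {a? = noDup? (gadgetRun zigzag-odd leftward)} tt
gadgetRun-noDup zigzag-even    leftward  = toWitness {a? = noDup? (gadgetRun zigzag-even leftward)} tt
gadgetRun-noDup extended-below leftward  = toWitness {a? = noDup? (gadgetRun extended-below leftward)} tt
gadgetRun-noDup extended-above leftward  = toWitness {a? = noDup? (gadgetRun extended-above leftward)} tt

gadgetPath-inBlock : ∀ g → All (InBlock g) (gadgetPath g)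
gadgetPath-inBlock zigzag-odd     = toWitness {a? = all? (inBlock? zigzag-odd) (gadgetPath zigzag-odd)} tt
gadgetPath-inBlock zigzag-even    = toWitness {a? = all? (inBlock? zigzag-even) (gadgetPath zigzag-even)} tt
gadgetPath-inBlock extended-below = toWitness {a? = all? (inBlock? extended-below) (gadgetPath extended-below)} tt
gadgetPath-inBlock extended-above = toWitness {a? = all? (inBlock? extended-above) (gadgetPath extended-above)} tt

gadgetPath-covers : ∀ g → All (_∈ gadgetPath g) (rectangle (height g))
gadgetPath-covers zigzag-odd     = toWitness {a? = all? (_∈? gadgetPath zigzag-odd) (rectangle 2)} tt
gadgetPath-covers zigzag-even    = toWitness {a? = all? (_∈? gadgetPath zigzag-even) (rectangle 2)} tt
gadgetPath-covers extended-below = toWitness {a? = all? (_∈? gadgetPath extended-below) (rectangle 4)} tt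
gadgetPath-covers extended-above = toWitness {a? = all? (_∈? gadgetPath extended-above) (rectangle 4)} tt

gadgetWalk-enters : ∀ g → Consecutive (0 , entryRow g) (1 , entryRow g) (gadgetWalk g rightward)
gadgetWalk-enters zigzag-odd     = here₂
gadgetWalk-enters zigzag-even    = here₂
gadgetWalk-enters extended-below = here₂
gadgetWalk-enters extended-above = here₂

gadgetWalk-exits : ∀ g → Consecutive (1 , entryRow g) (0 , entryRow g) (gadgetWalk g leftward)
gadgetWalk-exits zigzag-odd     = toWitness {a? = consecutive? (1 , 0) (0 , 0) (gadgetWalk zigzag-odd leftward)} tt
gadgetWalk-exits zigzag-even    = toWitness {a? = consecutive? (1 , 1) (0 , 1) (gadgetWalk zigzag-even leftward)} tt
gadgetWalk-exits extended-below = toWitness {a? = consecutive? (1 , 2) (0 , 2) (gadgetWalk extended-below leftward)} tt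
gadgetWalk-exits extended-above = toWitness {a? = consecutive? (1 , 1) (0 , 1) (gadgetWalk extended-above leftward)} tt

gadgetWalk-straights : ∀ g t → innerStraights (consecutiveWith isHorizontal (gadgetWalk g t)) ≡ gadgetStraights g
gadgetWalk-straights zigzag-odd     rightward = refl
gadgetWalk-straights zigzag-even    rightward = refl
gadgetWalk-straights extended-below rightward = refl
gadgetWalk-straights extended-above rightward = refl
gadgetWalk-straights zigzag-odd     leftward  = refl
gadgetWalk-straights zigzag-even    leftward  = refl
gadgetWalk-straights extended-below leftward  = refl
gadgetWalk-straights extended-above leftward  = refl

gadgetWalk-horizontalEnds : ∀ g t
  → ∃[ Y ] (consecutiveWith isHorizontal (gadgetWalk g t) ≡ true ∷ Y × lastOr true Y ≡ true)
gadgetWalk-horizontalEnds zigzag-odd     rightward = _ , refl , refl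
gadgetWalk-horizontalEnds zigzag-even    rightward = _ , refl , refl
gadgetWalk-horizontalEnds extended-below rightward = _ , refl , refl
gadgetWalk-horizontalEnds extended-above rightward = _ , refl , refl
gadgetWalk-horizontalEnds zigzag-odd     leftward  = _ , refl , refl
gadgetWalk-horizontalEnds zigzag-even    leftward  = _ , refl , refl
gadgetWalk-horizontalEnds extended-below leftward  = _ , refl , refl
gadgetWalk-horizontalEnds extended-above leftward  = _ , refl , refl

-- Rows in pairs {2p + 1, 2p + 2}

oddRow evenRow : ℕ → ℕ
oddRow  p = suc (p + p)
evenRow p = suc (suc (p + p))

pairIndex : ℕ → ℕ
pairIndex zero                = 0
pairIndex (suc zero)          = 0
pairIndex (suc (suc zero))    = 0
pairIndex (suc (suc (suc y))) = suc (pairIndex (suc y))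

isOdd : ℕ → Bool
isOdd zero          = false
isOdd (suc zero)    = true
isOdd (suc (suc y)) = isOdd y

oddRow-suc : ∀ p → oddRow (suc p) ≡ suc (suc (oddRow p))
oddRow-suc p = cong (λ z → suc (suc z)) (+-suc p p)

evenRow-suc : ∀ p → evenRow (suc p) ≡ suc (suc (evenRow p))
evenRow-suc p = cong (λ z → suc (suc (suc z))) (+-suc p p)

pairIndex-oddRow : ∀ p → pairIndex (oddRow p) ≡ p
pairIndex-oddRow zero    = refl
pairIndex-oddRow (suc p) rewrite +-suc p p = cong suc (pairIndex-oddRow p)

pairIndex-evenRow : ∀ p → pairIndex (evenRow p) ≡ p
pairIndex-evenRow zero    = refl
pairIndex-evenRow (suc p) rewrite +-suc p p = cong suc (pairIndex-evenRow p)

isOdd-oddRow : ∀ p → isOdd (oddRow p) ≡ true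
isOdd-oddRow zero    = refl
isOdd-oddRow (suc p) rewrite +-suc p p = isOdd-oddRow p

isOdd-evenRow : ∀ p → isOdd (evenRow p) ≡ false
isOdd-evenRow zero    = refl
isOdd-evenRow (suc p) rewrite +-suc p p = isOdd-evenRow p

row-pair : ∀ d → 1 ≤ d → d ≡ oddRow (pairIndex d) ⊎ d ≡ evenRow (pairIndex d)
row-pair (suc zero)          _ = inj₁ refl
row-pair (suc (suc zero))    _ = inj₂ refl
row-pair (suc (suc (suc d))) _ =
  Sum.map (λ eq → trans (cong (λ z → suc (suc z)) eq) (sym (oddRow-suc (pairIndex (suc d)))))
          (λ eq → trans (cong (λ z → suc (suc z)) eq) (sym (evenRow-suc (pairIndex (suc d)))))
          (row-pair (suc d) (s≤s z≤n))

oddRow≤⇒< : ∀ p h → oddRow p ≤ h + h → p < h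
oddRow≤⇒< p h le with p <? h
... | yes p<h = p<h
... | no p≮h = ⊥-elim (<⇒≱ (s≤s (+-mono-≤ (≮⇒≥ p≮h) (≮⇒≥ p≮h))) le)

oddRow≤⇒evenRow≤ : ∀ p h → oddRow p ≤ h + h → evenRow p ≤ h + h
oddRow≤⇒evenRow≤ p h le = subst (_≤ h + h) (cong suc (+-suc p p)) (+-mono-≤ p<h p<h)
  where p<h = oddRow≤⇒< p h le

2*suc∸1≡oddRow : ∀ p → 2 * suc p ∸ 1 ≡ oddRow p
2*suc∸1≡oddRow p = trans (cong (λ z → suc p + z ∸ 1) (+-identityʳ (suc p))) (+-suc p p)

2*suc≡evenRow : ∀ p → 2 * suc p ≡ evenRow p
2*suc≡evenRow p = trans (cong (suc p +_) (+-identityʳ (suc p))) (cong suc (+-suc p p))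

translate : ℕ → ℕ → Cell → Cell
translate x b (k , j) = (k + x , j + b)

translate-injective : ∀ x b p q → translate x b p ≡ translate x b q → p ≡ q
translate-injective x b (k , j) (k′ , j′) eq =
  cong₂ _,_ (+-cancelʳ-≡ x k k′ (cong proj₁ eq)) (+-cancelʳ-≡ b j j′ (cong proj₂ eq))

Adj-translate : ∀ x b p q → Adj p q → Adj (translate x b p) (translate x b q)
Adj-translate x b (k , j) (k′ , j′) adj = trans (cong₂ _+_ (∣+-+∣ x k k′) (∣+-+∣ b j j′)) adj
  where
  ∣+-+∣ : ∀ x k k′ → ∣ k + x - k′ + x ∣ ≡ ∣ k - k′ ∣
  ∣+-+∣ x k k′ = trans (cong₂ ∣_-_∣ (+-comm k x) (+-comm k′ x)) (∣m+n-m+o∣≡∣n-o∣ x k k′)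

consecutiveWith-translate : ∀ x b (xs : List Cell)
  → consecutiveWith isHorizontal (map (translate x b) xs) ≡ consecutiveWith isHorizontal xs
consecutiveWith-translate x b []       = refl
consecutiveWith-translate x b (o ∷ []) = refl
consecutiveWith-translate x b ((k , j) ∷ (k′ , j′) ∷ xs) =
  cong₂ _∷_ (≡ᵇ-+ b j j′) (consecutiveWith-translate x b ((k′ , j′) ∷ xs))
  where
  ≡ᵇ-+ : ∀ b j j′ → (j + b ≡ᵇ j′ + b) ≡ (j ≡ᵇ j′)
  ≡ᵇ-+ zero    j j′ = cong₂ _≡ᵇ_ (+-identityʳ j) (+-identityʳ j′)
  ≡ᵇ-+ (suc b) j j′ = trans (cong₂ _≡ᵇ_ (+-suc j b) (+-suc j′ b)) (≡ᵇ-+ b j j′)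

Crossing : ℕ → Traversal → ℕ → Cell → Cell → Set
Crossing x rightward y p q = p ≡ (x , y) × q ≡ (suc x , y)
Crossing x leftward  y p q = p ≡ (suc x , y) × q ≡ (x , y)

CrossesLine⇒Crossing : ∀ {x p q} → CrossesLine x p q → ∃[ t ] ∃[ y ] Crossing x t y p q
CrossesLine⇒Crossing (y , inj₁ c) = rightward , y , c
CrossesLine⇒Crossing (y , inj₂ c) = leftward , y , c

Crossing⇒CrossesLine : ∀ {x p q} t y → Crossing x t y p q → CrossesLine x p q
Crossing⇒CrossesLine rightward y c = y , inj₁ c
Crossing⇒CrossesLine leftward  y c = y , inj₂ c

CrossesLine-swap : ∀ {x p q} → CrossesLine x p q → CrossesLine x q p
CrossesLine-swap (y , c) = y , Sum.swap (Sum.map Product.swap Product.swap c)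

Crossing-row : ∀ {x p q} t y → Crossing x t y p q → proj₂ p ≡ y
Crossing-row rightward y (refl , _) = refl
Crossing-row leftward  y (refl , _) = refl

Crossing-horizontal : ∀ {x q r} t y → Crossing x t y q r → isHorizontal q r ≡ true
Crossing-horizontal rightward y (refl , refl) = Equivalence.to T-≡ (≡⇒≡ᵇ y y refl)
Crossing-horizontal leftward  y (refl , refl) = Equivalence.to T-≡ (≡⇒≡ᵇ y y refl)

Crossing-unique : ∀ {x p q} t t′ y y′ → Crossing x t y p q → Crossing x t′ y′ p q → t ≡ t′ × y ≡ y′
Crossing-unique rightward rightward y y′ (refl , _) (refl , _) = refl , refl
Crossing-unique leftward  leftward  y y′ (refl , _) (refl , _) = refl , refl
Crossing-unique rightward leftward  y y′ (refl , _) (() , _)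
Crossing-unique leftward  rightward y y′ (refl , _) (() , _)

Crossing⇒EdgeAt : ∀ {m n} (C : HamCycle m n) {x i} t y → Crossing x t y (cell C i) (cell C (suc i))
  → EdgeAt C i (x , y) (suc x , y)
Crossing⇒EdgeAt C rightward y c = inj₁ c
Crossing⇒EdgeAt C leftward  y c = inj₂ c

EdgeAt⇒Crossing : ∀ {m n} (C : HamCycle m n) {x i y} → EdgeAt C i (x , y) (suc x , y)
  → ∃[ t ] Crossing x t y (cell C i) (cell C (suc i))
EdgeAt⇒Crossing C (inj₁ c) = rightward , c
EdgeAt⇒Crossing C (inj₂ c) = leftward , c

Adj-across : ∀ x a b c d → a ≤ x → ¬ c ≤ x → Adj (a , b) (c , d) → CrossesLine x (a , b) (c , d)
Adj-across x a b c d a≤x c≰x adj = b , inj₁ (cong (_, b) a≡x , cong₂ _,_ (trans c≡1+a (cong suc a≡x)) (sym b≡d))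
  where
  a<c : a < c
  a<c = ≤-trans (s≤s a≤x) (≰⇒> c≰x)
  unit : ∀ u v → u + v ≡ 1 → 1 ≤ u → u ≡ 1 × v ≡ 0
  unit (suc zero) zero _ _ = refl , refl
  unit (suc zero) (suc v) () _
  unit (suc (suc u)) v () _
  c∸a≡1×b≡d : c ∸ a ≡ 1 × ∣ b - d ∣ ≡ 0
  c∸a≡1×b≡d = unit (c ∸ a) ∣ b - d ∣
    (trans (cong (_+ ∣ b - d ∣) (sym (m≤n⇒∣m-n∣≡n∸m (<⇒≤ a<c)))) adj) (m<n⇒0<n∸m a<c)
  b≡d : b ≡ d
  b≡d = ∣m-n∣≡0⇒m≡n (proj₂ c∸a≡1×b≡d)
  c≡1+a : c ≡ suc a
  c≡1+a = trans (sym (m+[n∸m]≡n (<⇒≤ a<c))) (trans (cong (a +_) (proj₁ c∸a≡1×b≡d)) (+-comm a 1))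
  a≡x : a ≡ x
  a≡x = ≤-antisym a≤x (≤-pred (subst (x <_) c≡1+a (≰⇒> c≰x)))

EvenlyExtensible-cong : ∀ n (S S′ : ℕ → Set) → (∀ y → S y → S′ y) → (∀ y → S′ y → S y)
  → EvenlyExtensible n S → EvenlyExtensible n S′
EvenlyExtensible-cong n S S′ to from (positive , (L , unique , L⇔S , length-L) , one-per-pair , (a , a-range , ¬a₁ , ¬a₂ , a-unique , a-next)) =
    (λ y s → positive y (from y s))
  , (L , unique , (λ y → mk⇔ (λ y∈ → to y (Equivalence.to (L⇔S y) y∈)) (λ s → Equivalence.from (L⇔S y) (from y s))) , length-L)
  , (λ b 1≤b s → one-per-pair b 1≤b (from _ (proj₁ s) , from _ (proj₂ s)))
  , ( a , a-range , (λ s → ¬a₁ (from _ s)) , (λ s → ¬a₂ (from _ s))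
    , (λ b 1≤b b≤ ¬b₁ ¬b₂ → a-unique b 1≤b b≤ (λ s → ¬b₁ (to _ s)) (λ s → ¬b₂ (to _ s)))
    , Sum.map (to _) (to _) a-next)

shift6 : Cell → Cell
shift6 (a , b) = (6 + a , b)

step-shift6 : ∀ d q → 1 ≤ proj₁ q → step d (shift6 q) ≡ shift6 (step d q)
step-shift6 right (a     , b) _ = refl
step-shift6 left  (suc a , b) _ = refl
step-shift6 up    (a     , b) _ = refl
step-shift6 down  (a     , b) _ = refl

column-step : ∀ d q → proj₁ q ∸ 1 ≤ proj₁ (step d q)
column-step right (a , b) = ≤-trans (m∸n≤m a 1) (n≤1+n a)
column-step left  (a , b) = ≤-refl
column-step up    (a , b) = m∸n≤m a 1
column-step down  (a , b) = m∸n≤m a 1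

column-mv : ∀ k d p → proj₁ p ∸ k ≤ proj₁ (mv k d p)
column-mv zero    d p = ≤-refl
column-mv (suc k) d p =
  ≤-trans (≤-reflexive (trans (cong (proj₁ p ∸_) (+-comm 1 k)) (sym (∸-+-assoc (proj₁ p) k 1))))
    (≤-trans (∸-monoˡ-≤ 1 (column-mv k d p)) (column-step d (mv k d p)))

-- k ≤ column keeps the moves away from column 0, where step left truncates.
mv-shift6 : ∀ k d p → k ≤ proj₁ p → mv k d (shift6 p) ≡ shift6 (mv k d p)
mv-shift6 zero    d p _   = refl
mv-shift6 (suc k) d p k<a =
  trans (cong (step d) (mv-shift6 k d p (≤-trans (n≤1+n k) k<a)))
        (step-shift6 d (mv k d p) (≤-trans 1≤a∸k (column-mv k d p)))
  where
  1≤a∸k : 1 ≤ proj₁ p ∸ k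
  1≤a∸k = ≤-trans (≤-reflexive (sym (m+n∸m≡n k 1))) (∸-monoˡ-≤ k (subst (_≤ proj₁ p) (+-comm 1 k) k<a))

mv₂-shift6 : ∀ j k d₁ d₂ p → k + j ≤ proj₁ p → mv j d₂ (mv k d₁ (shift6 p)) ≡ shift6 (mv j d₂ (mv k d₁ p))
mv₂-shift6 j k d₁ d₂ p k+j≤a =
  trans (cong (mv j d₂) (mv-shift6 k d₁ p (≤-trans (m≤m+n k j) k+j≤a)))
        (mv-shift6 j d₂ (mv k d₁ p)
          (≤-trans (≤-trans (≤-reflexive (sym (m+n∸m≡n k j))) (∸-monoˡ-≤ k k+j≤a)) (column-mv k d₁ p)))

Tpath-shift6 : ∀ c u v → 3 ≤ proj₁ c → Tpath (shift6 c) u v ≡ map shift6 (Tpath c u v)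
Tpath-shift6 c u v 3≤c =
  cong (shift6 c ∷_) (cong₂ _∷_ (mv-shift6 1 u c (≤-trans (s≤s z≤n) 3≤c))
    (cong₂ _∷_ (mv-shift6 2 u c (≤-trans (s≤s (s≤s z≤n)) 3≤c)) (cong (_∷ []) (mv-shift6 3 u c 3≤c))))

Upath-shift6 : ∀ c u v → 5 ≤ proj₁ c → Upath (shift6 c) u v ≡ map shift6 (Upath c u v)
Upath-shift6 c u v 5≤c =
  cong₂ _∷_ (mv₂-shift6 2 3 u v c 5≤c)
  (cong₂ _∷_ (mv₂-shift6 1 3 u v c (≤c 4))
  (cong₂ _∷_ (mv₂-shift6 0 3 u v c (≤c 3))
  (cong₂ _∷_ (mv₂-shift6 0 2 u v c (≤c 2))
  (cong₂ _∷_ (mv₂-shift6 1 2 u v c (≤c 3))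
  (cong₂ _∷_ (mv₂-shift6 1 1 u v c (≤c 2))
  (cong₂ _∷_ (mv₂-shift6 0 1 u v c (≤c 1))
  (cong (shift6 c ∷_)
  (cong₂ _∷_ (mv₂-shift6 1 0 u v c (≤c 1))
  (cong (_∷ []) (mv₂-shift6 2 0 u v c (≤c 2)))))))))))
  where
  ≤c : ∀ k {k≤5 : True (k ≤? 5)} → k ≤ proj₁ c
  ≤c k {k≤5} = ≤-trans (toWitness k≤5) 5≤c

CornerFrame-widen : ∀ {m n c u v} → CornerFrame m n c u v
  → (c ≡ (1 , proj₂ c) × CornerFrame (m + 6) n c u v)
  ⊎ (c ≡ (m , proj₂ c) × CornerFrame (m + 6) n (shift6 c) u v)
CornerFrame-widen c11 = inj₁ (refl , c11)
CornerFrame-widen c1n = inj₁ (refl , c1n)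
CornerFrame-widen {m} {n} cm1 = inj₂ (refl , subst (λ M → CornerFrame (m + 6) n (M , 1) left up) (+-comm m 6) cm1)
CornerFrame-widen {m} {n} cmn = inj₂ (refl , subst (λ M → CornerFrame (m + 6) n (M , n) left down) (+-comm m 6) cmn)
CornerFrame-widen (swp f) = Sum.map (Product.map₂ swp) (Product.map₂ swp) (CornerFrame-widen f)

byCases : ∀ (P : ℕ → Set) r y → P r → (y ≢ r → P y) → P y
byCases P r y Pr P≢ with y ≟ r
... | yes refl = Pr
... | no y≢r   = P≢ y≢r

module Layout {m n : ℕ} (C : HamCycle m n) (x : ℕ) (special : Gadget) (p : ℕ) where

  Crosses : ℕ → Set
  Crosses = CrossSet C x

  specialRow : ℕ
  specialRow = entryRow special + oddRow p

  gadgetFor : ℕ → Gadget × ℕ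
  gadgetFor y with y ≟ specialRow | isOdd y
  ... | yes _ | _     = special , oddRow p
  ... | no _  | true  = zigzag-odd , y
  ... | no _  | false = zigzag-even , y ∸ 1

  gadgetOf : ℕ → Gadget
  gadgetOf y = proj₁ (gadgetFor y)

  baseOf : ℕ → ℕ
  baseOf y = proj₂ (gadgetFor y)

  entryRow-gadgetOf : ∀ y → 1 ≤ y → entryRow (gadgetOf y) + baseOf y ≡ y
  entryRow-gadgetOf y 1≤y with y ≟ specialRow | isOdd y
  ... | yes eq | _     = sym eq
  ... | no _   | true  = refl
  ... | no _   | false = m+[n∸m]≡n 1≤y

  gadgetFor-specialRow : gadgetFor specialRow ≡ (special , oddRow p)
  gadgetFor-specialRow with specialRow ≟ specialRow
  ... | yes _  = refl
  ... | no ≢rs = ⊥-elim (≢rs refl)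

  zigzag-otherRow : ∀ y → y ≢ specialRow → 1 ≤ y
    → baseOf y ≡ oddRow (pairIndex y) × height (gadgetOf y) ≡ 2 × gadgetStraights (gadgetOf y) ≡ 0
  zigzag-otherRow y y≢rs 1≤y with y ≟ specialRow | isOdd y in odd≡
  ... | yes eq | _ = ⊥-elim (y≢rs eq)
  ... | no _ | true with row-pair y 1≤y
  ...   | inj₁ eq = eq , refl , refl
  ...   | inj₂ eq = ⊥-elim (true≢false (trans (sym odd≡) (trans (cong isOdd eq) (isOdd-evenRow (pairIndex y)))))
    where true≢false : true ≢ false
          true≢false ()
  zigzag-otherRow y y≢rs 1≤y | no _ | false with row-pair y 1≤y
  ...   | inj₂ eq = cong (_∸ 1) eq , refl , refl
  ...   | inj₁ eq = ⊥-elim (true≢false (trans (sym (isOdd-oddRow (pairIndex y))) (trans (cong isOdd (sym eq)) odd≡)))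
    where true≢false : true ≢ false
          true≢false ()

  record Placement : Set where
    field
      block-inGrid : ∀ y → Crosses y → ∀ j → j < height (gadgetOf y) → 1 ≤ j + baseOf y × j + baseOf y ≤ n
      block-disjoint : ∀ y y′ → Crosses y → Crosses y′ → y ≢ y′ → ∀ j j′
        → j < height (gadgetOf y) → j′ < height (gadgetOf y′) → j + baseOf y ≢ j′ + baseOf y′
      block-cover : ∀ d → 1 ≤ d → d ≤ n
        → ∃[ y ] (Crosses y × ∃[ j ] (j < height (gadgetOf y) × d ≡ j + baseOf y))
      specialRow-crosses : Crosses specialRow
      special-straights : gadgetStraights special ≡ 4

module Insertion {m n : ℕ} (C : HamCycle m n) (K : ℕ) (mn≡N : m * n ≡ suc K) (2<N : 2 < suc K)
  (x : ℕ) (1≤x : 1 ≤ x) (x<m : x < m) (special : Gadget) (p : ℕ)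
  (placement : Layout.Placement C x special p) where

  open Period C K mn≡N
  open Layout C x special p
  open Placement placement

  embed : Cell → Cell
  embed (a , b) with a ≤? x
  ... | yes _ = (a , b)
  ... | no  _ = (6 + a , b)

  embed-left : ∀ a b → a ≤ x → embed (a , b) ≡ (a , b)
  embed-left a b a≤x with a ≤? x
  ... | yes _  = refl
  ... | no a≰x = ⊥-elim (a≰x a≤x)

  embed-right : ∀ a b → x < a → embed (a , b) ≡ (6 + a , b)
  embed-right a b x<a with a ≤? x
  ... | yes a≤x = ⊥-elim (<⇒≱ x<a a≤x)
  ... | no _    = refl

  embed-row : ∀ q → proj₂ (embed q) ≡ proj₂ q
  embed-row (a , b) with a ≤? x
  ... | yes _ = refl
  ... | no  _ = refl

  embed-column : ∀ q → proj₁ (embed q) ≤ x ⊎ 7 + x ≤ proj₁ (embed q)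
  embed-column (a , b) with a ≤? x
  ... | yes a≤x = inj₁ a≤x
  ... | no a≰x  = inj₂ (+-monoʳ-≤ 6 (≰⇒> a≰x))

  embed-injective : ∀ q r → embed q ≡ embed r → q ≡ r
  embed-injective (a , b) (c , d) eq with a ≤? x | c ≤? x
  ... | yes _   | yes _   = eq
  ... | no _    | no _    = cong₂ _,_ (+-cancelˡ-≡ 6 a c (cong proj₁ eq)) (cong proj₂ eq)
  ... | yes a≤x | no c≰x  = ⊥-elim (c≰x (≤-trans (≤-trans (m≤n+m c 6) (≤-reflexive (sym (cong proj₁ eq)))) a≤x))
  ... | no a≰x  | yes c≤x = ⊥-elim (a≰x (≤-trans (≤-trans (m≤n+m a 6) (≤-reflexive (cong proj₁ eq))) c≤x))

  embed≢column[1+x] : ∀ q y → embed q ≢ (suc x , y)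
  embed≢column[1+x] q y eq with embed-column q
  ... | inj₁ col≤x   = 1+n≰n (subst (_≤ x) (cong proj₁ eq) col≤x)
  ... | inj₂ 7+x≤col = 1+n≰n (≤-trans (m≤n+m (suc x) 5) (≤-pred (subst (7 + x ≤_) (cong proj₁ eq) 7+x≤col)))

  embed-noCrossing : ∀ q r → ¬ CrossesLine x (embed q) (embed r)
  embed-noCrossing q r (y , inj₁ (_ , eq)) = embed≢column[1+x] r y eq
  embed-noCrossing q r (y , inj₂ (eq , _)) = embed≢column[1+x] q y eq

  embed-Crossing : ∀ t y {q r} → Crossing x t y q r
    → embed q ≡ (entryColumn t + x , y) × embed r ≡ (exitColumn t + x , y)
  embed-Crossing rightward y (refl , refl) = embed-left x y ≤-refl , embed-right (suc x) y ≤-refl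
  embed-Crossing leftward  y (refl , refl) = embed-right (suc x) y ≤-refl , embed-left x y ≤-refl

  Adj-embed : ∀ q r → Adj q r → ¬ CrossesLine x q r → Adj (embed q) (embed r)
  Adj-embed (a , b) (c , d) adj ¬cross with a ≤? x | c ≤? x
  ... | yes _   | yes _   = adj
  ... | no _    | no _    = trans (cong (_+ ∣ b - d ∣) (∣m+n-m+o∣≡∣n-o∣ 6 a c)) adj
  ... | yes a≤x | no c≰x  = ⊥-elim (¬cross (Adj-across x a b c d a≤x c≰x adj))
  ... | no a≰x  | yes c≤x = ⊥-elim (¬cross (CrossesLine-swap (Adj-across x c d a b c≤x a≰x (Adj-swap (a , b) (c , d) adj))))

  crossing? : ∀ t q r → Dec (Crossing x t (proj₂ q) q r)
  crossing? rightward q r = (q ≟ᶜ (x , proj₂ q)) ×-dec (r ≟ᶜ (suc x , proj₂ q))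
  crossing? leftward  q r = (q ≟ᶜ (suc x , proj₂ q)) ×-dec (r ≟ᶜ (x , proj₂ q))

  data CrossingKind (q r : Cell) : Set where
    crossing   : ∀ t y → Crossing x t y q r → CrossingKind q r
    noCrossing : ¬ CrossesLine x q r → CrossingKind q r

  crossingKind : ∀ q r → CrossingKind q r
  crossingKind q r with crossing? rightward q r | crossing? leftward q r
  ... | yes c | _     = crossing rightward _ c
  ... | no _  | yes c = crossing leftward _ c
  ... | no ¬c₁ | no ¬c₂ = noCrossing λ cross → let (t , y , c) = CrossesLine⇒Crossing cross in refute t y c
    where
    refute : ∀ t y → Crossing x t y q r → ⊥
    refute rightward y c = ¬c₁ (subst (λ z → Crossing x rightward z q r) (sym (Crossing-row rightward y c)) c)
    refute leftward  y c = ¬c₂ (subst (λ z → Crossing x leftward z q r) (sym (Crossing-row leftward y c)) c)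

  detourOf : ∀ {q r} → CrossingKind q r → List Cell
  detourOf (crossing t y _) = map (translate x (baseOf y)) (gadgetRun (gadgetOf y) t)
  detourOf (noCrossing _)   = []

  anchor : ℕ → Cell
  anchor i = embed (cell C i)

  detour : ℕ → List Cell
  detour i = detourOf (crossingKind (cell C i) (cell C (suc i)))

  newLink : ℕ → List Cell
  newLink = link anchor detour

  data View (i : ℕ) : Set where
    crossing : ∀ t y → 1 ≤ y → Crossing x t y (cell C i) (cell C (suc i))
      → detour i ≡ map (translate x (baseOf y)) (gadgetRun (gadgetOf y) t)
      → newLink i ≡ map (translate x (baseOf y)) (gadgetWalk (gadgetOf y) t) → View i
    noCrossing : ¬ CrossesLine x (cell C i) (cell C (suc i)) → detour i ≡ [] → View i

  view : ∀ i → View i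
  view i with crossingKind (cell C i) (cell C (suc i)) in kind≡
  ... | noCrossing ¬cross = noCrossing ¬cross (cong detourOf kind≡)
  ... | crossing t y c = crossing t y 1≤y c (cong detourOf kind≡) (begin
      anchor i ∷ detour i ++ [ anchor (suc i) ]
        ≡⟨ cong₂ (λ u v → u ∷ detour i ++ [ v ]) (trans (proj₁ ends) (cong (_ ,_) (sym entry)))
                                                 (trans (proj₂ ends) (cong (_ ,_) (sym entry))) ⟩
      T (entryColumn t , entryRow g) ∷ detour i ++ [ T (exitColumn t , entryRow g) ]
        ≡⟨ cong (λ z → T (entryColumn t , entryRow g) ∷ z ++ [ T (exitColumn t , entryRow g) ]) (cong detourOf kind≡) ⟩
      T (entryColumn t , entryRow g) ∷ map T (gadgetRun g t) ++ map T [ (exitColumn t , entryRow g) ]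
        ≡⟨ cong (T (entryColumn t , entryRow g) ∷_) (sym (map-++ T (gadgetRun g t) _)) ⟩
      map T (gadgetWalk g t) ∎)
    where
    open ≡-Reasoning
    g = gadgetOf y
    T = translate x (baseOf y)
    1≤y : 1 ≤ y
    1≤y = subst (1 ≤_) (Crossing-row t y c) (proj₁ (proj₂ (inGrid C i)))
    entry : entryRow g + baseOf y ≡ y
    entry = entryRow-gadgetOf y 1≤y
    ends = embed-Crossing t y c

  crossing-crosses : ∀ i t y → Crossing x t y (cell C i) (cell C (suc i)) → Crosses y
  crossing-crosses i t y c =
    subst (λ z → 1 ≤ z × z ≤ n) (Crossing-row t y c) (proj₂ (inGrid C i)) , i , Crossing⇒EdgeAt C t y c

  DetourCell : ℕ → Cell → Set
  DetourCell i z = ∃[ y ] ∃[ k ] ∃[ j ]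
    ( EdgeAt C i (x , y) (suc x , y) × Crosses y × z ≡ (k + x , j + baseOf y)
    × (1 ≤ k × k ≤ 6) × j < height (gadgetOf y))

  detour-cell : ∀ i z → z ∈ detour i → DetourCell i z
  detour-cell i z z∈ with view i
  ... | noCrossing _ detour≡ with subst (z ∈_) detour≡ z∈
  ...   | ()
  detour-cell i z z∈ | crossing t y _ c detour≡ _ with ∈-map⁻ (translate x (baseOf y)) (subst (z ∈_) detour≡ z∈)
  ...   | (k , j) , o∈ , refl =
    y , k , j , Crossing⇒EdgeAt C t y c , crossing-crosses i t y c , refl
      , All.lookup (gadgetPath-inBlock (gadgetOf y)) (gadgetRun⊆gadgetPath (gadgetOf y) t o∈)

  anchor∉detour : ∀ q i z → z ∈ detour i → embed q ≢ z
  anchor∉detour q i z z∈ eq with detour-cell i z z∈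
  ... | y , k , j , _ , _ , refl , (1≤k , k≤6) , _ with embed-column q
  ...   | inj₁ col≤x   = 1+n≰n (≤-trans (+-monoˡ-≤ x 1≤k) (subst (_≤ x) (cong proj₁ eq) col≤x))
  ...   | inj₂ 7+x≤col = 1+n≰n (≤-trans (+-monoˡ-≤ x (s≤s k≤6)) (subst (7 + x ≤_) (cong proj₁ eq) 7+x≤col))

  detour-noDup : ∀ i → NoDup (detour i)
  detour-noDup i with view i
  ... | noCrossing _ detour≡ = subst NoDup (sym detour≡) []
  ... | crossing t y _ _ detour≡ _ = subst NoDup (sym detour≡)
    (NoDup-map (translate x (baseOf y)) (translate-injective x (baseOf y)) _ (gadgetRun-noDup (gadgetOf y) t))

  newStep : ℕ → List Cell
  newStep i = anchor i ∷ detour i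

  newCells : List Cell
  newCells = concatUpTo newStep N

  newSteps-disjoint : ∀ i i′ z → i < N → i′ < N → z ∈ newStep i → z ∈ newStep i′ → i ≡ i′
  newSteps-disjoint i i′ z i<N i′<N (here refl) (here eq)  = cell-injective i i′ i<N i′<N (embed-injective _ _ eq)
  newSteps-disjoint i i′ z i<N i′<N (here refl) (there z∈) = ⊥-elim (anchor∉detour _ i′ z z∈ refl)
  newSteps-disjoint i i′ z i<N i′<N (there z∈) (here refl) = ⊥-elim (anchor∉detour _ i z z∈ refl)
  newSteps-disjoint i i′ z i<N i′<N (there z∈) (there z∈′) with detour-cell i z z∈ | detour-cell i′ z z∈′
  ... | y , _ , j , edge , crosses , z≡ , _ , j< | y′ , _ , j′ , edge′ , crosses′ , z≡′ , _ , j′< with y ≟ y′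
  ...   | yes refl = EdgeAt-unique i i′ 2<N i<N i′<N edge edge′
  ...   | no y≢y′  = ⊥-elim (block-disjoint y y′ crosses crosses′ y≢y′ j j′ j< j′< (trans (sym (cong proj₂ z≡)) (cong proj₂ z≡′)))

  newCells-noDup : NoDup newCells
  newCells-noDup = NoDup-concatUpTo newStep N
    (λ i _ → (λ z∈ → anchor∉detour (cell C i) i _ z∈ refl) ∷ detour-noDup i) newSteps-disjoint

  embed-inGrid : ∀ q → InGrid m n q → InGrid (m + 6) n (embed q)
  embed-inGrid (a , b) ((1≤a , a≤m) , row) with a ≤? x
  ... | yes _ = (1≤a , ≤-trans a≤m (m≤m+n m 6)) , row
  ... | no _  = (≤-trans 1≤a (m≤n+m a 6) , subst (6 + a ≤_) (+-comm 6 m) (+-monoʳ-≤ 6 a≤m)) , row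

  newCells-inGrid : ∀ z → z ∈ newCells → InGrid (m + 6) n z
  newCells-inGrid z z∈ with ∈-concatUpTo⁻ newStep N z∈
  ... | i , _ , here refl = embed-inGrid (cell C i) (inGrid C i)
  ... | i , _ , there z∈detour with detour-cell i z z∈detour
  ...   | y , k , j , _ , crosses , refl , (1≤k , k≤6) , j< =
    ( ≤-trans 1≤k (m≤m+n k x)
    , ≤-trans (+-monoˡ-≤ x k≤6) (≤-trans (+-monoʳ-≤ 6 (<⇒≤ x<m)) (≤-reflexive (+-comm 6 m))))
    , block-inGrid y crosses j j<

  cell-index : ∀ q → InGrid m n q → ∃[ i ] (i < N × cell C i ≡ q)
  cell-index q q∈grid with surjective C q q∈grid
  ... | i , i< , eq = i , subst (i <_) mn≡N i< , eq

  rectangle-∈ : ∀ k j h → 1 ≤ k → k ≤ 6 → j < h → (k , j) ∈ rectangle h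
  rectangle-∈ (suc k) j h _ k<6 j<h =
    ∈-concatUpTo⁺ (λ k → applyUpTo (λ j → (suc k , j)) h) 6 k k<6 (∈-applyUpTo⁺ (λ j → (suc k , j)) j<h)

  anchor-∈ : ∀ q → InGrid m n q → embed q ∈ newCells
  anchor-∈ q q∈grid with cell-index q q∈grid
  ... | i , i<N , eq = ∈-concatUpTo⁺ newStep N i i<N (here (cong embed (sym eq)))

  detour-∈ : ∀ i k j y → 1 ≤ k → k ≤ 6 → j < height (gadgetOf y) → EdgeAt C i (x , y) (suc x , y)
    → (k + x , j + baseOf y) ∈ detour i
  detour-∈ i k j y 1≤k k≤6 j< edge with view i | EdgeAt⇒Crossing C edge
  ... | noCrossing ¬cross _ | t , c = ⊥-elim (¬cross (Crossing⇒CrossesLine t y c))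
  ... | crossing t′ y′ _ c′ detour≡ _ | t , c with Crossing-unique t t′ y y′ c c′
  ...   | refl , refl = subst ((k + x , j + baseOf y) ∈_) (sym detour≡)
    (∈-map⁺ (translate x (baseOf y))
      (gadgetPath⊆gadgetRun (gadgetOf y) t (All.lookup (gadgetPath-covers (gadgetOf y)) (rectangle-∈ k j _ 1≤k k≤6 j<))))

  middle-∈ : ∀ c d → x < c → c < 7 + x → 1 ≤ d → d ≤ n → (c , d) ∈ newCells
  middle-∈ c d x<c c<7+x 1≤d d≤n with block-cover d 1≤d d≤n
  ... | y , (_ , uses) , j , j< , refl with UsesEdge⇒EdgeAt uses
  ...   | i , i<N , edge = ∈-concatUpTo⁺ newStep N i i<N
    (there (subst (λ z → (z , j + baseOf y) ∈ detour i) (m∸n+n≡m (<⇒≤ x<c)) (detour-∈ i (c ∸ x) j y 1≤k k≤6 j< edge)))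
    where
    1≤k : 1 ≤ c ∸ x
    1≤k = m<n⇒0<n∸m x<c
    k≤6 : c ∸ x ≤ 6
    k≤6 = +-cancelʳ-≤ x (c ∸ x) 6 (≤-pred (subst (_< 7 + x) (sym (m∸n+n≡m (<⇒≤ x<c))) c<7+x))

  newCells-cover : ∀ z → InGrid (m + 6) n z → z ∈ newCells
  newCells-cover (c , d) ((1≤c , c≤m+6) , row) with c ≤? x | 7 + x ≤? c
  ... | yes c≤x | _ = subst (_∈ newCells) (embed-left c d c≤x) (anchor-∈ (c , d) ((1≤c , ≤-trans c≤x (<⇒≤ x<m)) , row))
  ... | no c≰x | no 7+x≰c = middle-∈ c d (≰⇒> c≰x) (≰⇒> 7+x≰c) (proj₁ row) (proj₂ row)
  ... | no _ | yes 7+x≤c =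
    subst (_∈ newCells) (trans (embed-right (c ∸ 6) d x<c∸6) (cong (_, d) (m+[n∸m]≡n 6≤c)))
      (anchor-∈ (c ∸ 6 , d) ((≤-trans 1≤x (<⇒≤ x<c∸6) , c∸6≤m) , row))
    where
    x<c∸6 : x < c ∸ 6
    x<c∸6 = ∸-monoˡ-≤ 6 7+x≤c
    6≤c : 6 ≤ c
    6≤c = ≤-trans (m≤m+n 6 (suc x)) 7+x≤c
    c∸6≤m : c ∸ 6 ≤ m
    c∸6≤m = ≤-trans (∸-monoˡ-≤ 6 c≤m+6) (≤-reflexive (m+n∸n≡m m 6))

  newLink-adjacent : ∀ i → AllEdges Adj (newLink i)
  newLink-adjacent i with view i
  ... | crossing t y _ _ _ link≡ = subst (AllEdges Adj) (sym link≡)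
    (AllEdges-map (translate x (baseOf y)) (Adj-translate x (baseOf y)) _ (gadgetWalk-adjacent (gadgetOf y) t))
  ... | noCrossing ¬cross detour≡ rewrite detour≡ = Adj-embed (cell C i) (cell C (suc i)) (adjacent C i) ¬cross , tt

  chain≡newCells : chain anchor detour N ≡ newCells ++ [ anchor 0 ]
  chain≡newCells = cong (λ z → newCells ++ [ z ]) (cong embed cell-N)

  module New = CycleFromList (m + 6) n (anchor 0) (detour 0 ++ concatUpTo (λ i → newStep (suc i)) K)
    (sym (length-≡-gridSize (m + 6) n newCells newCells-noDup newCells-inGrid newCells-cover))
    newCells-noDup newCells-inGrid newCells-cover
    (subst (AllEdges Adj) chain≡newCells (AllEdges-chain anchor detour N (λ i _ → newLink-adjacent i)))

  newCycle : HamCycle (m + 6) n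
  newCycle = New.cycle

  linkOrientations : ∀ i → ∃[ Y ] ( consecutiveWith isHorizontal (newLink i) ≡ orientation C i ∷ Y
                                  × lastOr (orientation C i) Y ≡ orientation C i)
  linkOrientations i with view i
  ... | noCrossing _ detour≡ rewrite detour≡ =
    [] , cong (_∷ []) (cong₂ _≡ᵇ_ (embed-row (cell C i)) (embed-row (cell C (suc i)))) , refl
  ... | crossing t y _ c _ link≡ with gadgetWalk-horizontalEnds (gadgetOf y) t
  ...   | Y , orientations≡ , last≡ rewrite Crossing-horizontal t y c =
    Y , trans (cong (consecutiveWith isHorizontal) link≡)
              (trans (consecutiveWith-translate x (baseOf y) (gadgetWalk (gadgetOf y) t)) orientations≡)
      , last≡

  linkTail : ℕ → List Bool
  linkTail i = proj₁ (linkOrientations i)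

  linkStraights : ℕ → ℕ
  linkStraights i = innerStraights (consecutiveWith isHorizontal (newLink i))

  crossing-linkStraights : ∀ i t y → Crossing x t y (cell C i) (cell C (suc i))
    → linkStraights i ≡ gadgetStraights (gadgetOf y)
  crossing-linkStraights i t y c with view i
  ... | noCrossing ¬cross _ = ⊥-elim (¬cross (Crossing⇒CrossesLine t y c))
  ... | crossing t′ y′ _ c′ _ link≡ with Crossing-unique t′ t y′ y c′ c
  ...   | refl , refl = trans (cong innerStraights (trans (cong (consecutiveWith isHorizontal) link≡)
                                 (consecutiveWith-translate x (baseOf y) (gadgetWalk (gadgetOf y) t))))
                             (gadgetWalk-straights (gadgetOf y) t)

  specialStep : ∃[ i ] (i < N × EdgeAt C i (x , specialRow) (suc x , specialRow))
  specialStep = UsesEdge⇒EdgeAt (proj₂ specialRow-crosses)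

  i₀ : ℕ
  i₀ = proj₁ specialStep

  linkStraights-special : linkStraights i₀ ≡ 4
  linkStraights-special with EdgeAt⇒Crossing C (proj₂ (proj₂ specialStep))
  ... | t , c = trans (crossing-linkStraights i₀ t specialRow c)
                      (trans (cong (λ gb → gadgetStraights (proj₁ gb)) gadgetFor-specialRow) special-straights)

  linkStraights-other : ∀ i → i < N → i ≢ i₀ → linkStraights i ≡ 0
  linkStraights-other i i<N i≢i₀ with view i
  ... | noCrossing _ detour≡ rewrite detour≡ = refl
  ... | crossing t y 1≤y c _ _ = trans (crossing-linkStraights i t y c) (proj₂ (proj₂ (zigzag-otherRow y y≢rs 1≤y)))
    where
    y≢rs : y ≢ specialRow
    y≢rs refl = i≢i₀ (EdgeAt-unique i i₀ 2<N i<N (proj₁ (proj₂ specialStep)) (Crossing⇒EdgeAt C t y c) (proj₂ (proj₂ specialStep)))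

  orientation-N : orientation C N ≡ orientation C 0
  orientation-N = cong₂ isHorizontal cell-N (subst (λ M → cell C (suc M) ≡ cell C 1) mn≡N (periodic C 1))

  newOrientations : consecutiveWith isHorizontal New.closed ≡ concatUpTo (λ i → orientation C i ∷ linkTail i) N
  newOrientations = begin
    consecutiveWith isHorizontal New.closed
      ≡⟨ cong (consecutiveWith isHorizontal) (sym chain≡newCells) ⟩
    consecutiveWith isHorizontal (chain anchor detour N)
      ≡⟨ consecutiveWith-chain isHorizontal anchor detour N ⟩
    concatUpTo (λ i → consecutiveWith isHorizontal (newLink i)) N
      ≡⟨ concatUpTo-cong _ _ N (λ i → proj₁ (proj₂ (linkOrientations i))) ⟩
    concatUpTo (λ i → orientation C i ∷ linkTail i) N ∎
    where open ≡-Reasoning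

  numStraights-newCycle : numStraights newCycle ≡ 4 + numStraights C
  numStraights-newCycle = begin
    numStraights newCycle
      ≡⟨ New.numStraights-cycle ⟩
    innerStraights (consecutiveWith isHorizontal New.closed ++ [ orientation newCycle 0 ])
      ≡⟨ cong₂ (λ u v → innerStraights (u ++ [ v ])) newOrientations first-orientation ⟩
    innerStraights (chain (orientation C) linkTail N)
      ≡⟨ innerStraights-chain (orientation C) linkTail N (λ i → proj₂ (proj₂ (linkOrientations i))) ⟩
    sumUpTo (λ i → innerStraights (orientation C i ∷ linkTail i)) N + innerStraights (applyUpTo (orientation C) N ++ [ orientation C N ])
      ≡⟨ cong₂ _+_ links-straights (cong (λ b → innerStraights (applyUpTo (orientation C) N ++ [ b ])) orientation-N) ⟩
    4 + innerStraights (applyUpTo (orientation C) N ++ [ orientation C 0 ])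
      ≡⟨ cong (λ M → 4 + innerStraights (applyUpTo (orientation C) M ++ [ orientation C 0 ])) (sym mn≡N) ⟩
    4 + innerStraights (applyUpTo (orientation C) (m * n) ++ [ orientation C 0 ])
      ≡⟨ cong (4 +_) (sym (numStraights≡innerStraights C)) ⟩
    4 + numStraights C ∎
    where
    open ≡-Reasoning
    first-orientation : orientation newCycle 0 ≡ orientation C N
    first-orientation =
      trans (cong (λ bs → nth false bs 0) (trans New.orientations newOrientations)) (sym orientation-N)
    linkStraights≡ : ∀ i → innerStraights (orientation C i ∷ linkTail i) ≡ linkStraights i
    linkStraights≡ i = cong innerStraights (sym (proj₁ (proj₂ (linkOrientations i))))
    links-straights : sumUpTo (λ i → innerStraights (orientation C i ∷ linkTail i)) N ≡ 4
    links-straights = trans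
      (sumUpTo-single _ N i₀ (proj₁ (proj₂ specialStep))
        (λ i i<N i≢i₀ → trans (linkStraights≡ i) (linkStraights-other i i<N i≢i₀)))
      (trans (linkStraights≡ i₀) linkStraights-special)

  Consecutive-newLink⇒UsesEdge : ∀ {a b} i → i < N → Consecutive a b (newLink i) → UsesEdge newCycle a b
  Consecutive-newLink⇒UsesEdge {a} {b} i i<N c =
    New.Consecutive⇒UsesEdge (subst (Consecutive a b) chain≡newCells (Consecutive-chain⁺ anchor detour N i i<N c))

  -- Each crossing edge of C survives as the first (or last) edge of its detour.
  crossing-newUsesEdge : ∀ i t y → 1 ≤ y → Crossing x t y (cell C i) (cell C (suc i)) → i < N
    → UsesEdge newCycle (x , y) (suc x , y)
  crossing-newUsesEdge i t y 1≤y c i<N with view i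
  ... | noCrossing ¬cross _ = ⊥-elim (¬cross (Crossing⇒CrossesLine t y c))
  ... | crossing t′ y′ _ c′ _ link≡ with Crossing-unique t′ t y′ y c′ c
  ...   | refl , refl = kept t link≡
    where
    g = gadgetOf y
    T = translate x (baseOf y)
    entry = entryRow-gadgetOf y 1≤y
    kept : ∀ t → newLink i ≡ map T (gadgetWalk g t) → UsesEdge newCycle (x , y) (suc x , y)
    kept rightward link≡ = Consecutive-newLink⇒UsesEdge i i<N
      (subst₂ (λ u v → Consecutive u v (newLink i)) (cong (x ,_) entry) (cong (suc x ,_) entry)
        (subst (Consecutive _ _) (sym link≡) (Consecutive-map⁺ T (gadgetWalk g rightward) (gadgetWalk-enters g))))
    kept leftward  link≡ = UsesEdge-swap {C = newCycle} (Consecutive-newLink⇒UsesEdge i i<N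
      (subst₂ (λ u v → Consecutive u v (newLink i)) (cong (suc x ,_) entry) (cong (x ,_) entry)
        (subst (Consecutive _ _) (sym link≡) (Consecutive-map⁺ T (gadgetWalk g leftward) (gadgetWalk-exits g)))))

  crosses⇒newCrosses : ∀ y → Crosses y → CrossSet newCycle x y
  crosses⇒newCrosses y (bounds , uses) with UsesEdge⇒EdgeAt uses
  ... | i , i<N , edge with EdgeAt⇒Crossing C edge
  ...   | t , c = bounds , crossing-newUsesEdge i t y (proj₁ bounds) c i<N

  translate-crossingRow : ∀ g b t y o o′ → EntryEdge g o o′ → Crossing x t y (translate x b o) (translate x b o′)
    → entryRow g + b ≡ y
  translate-crossingRow g b rightward y (k , j) o′ entry (at-x , _) =
    trans (cong (_+ b) (sym (proj₁ (entry (inj₁ (+-cancelʳ-≡ x k 0 (cong proj₁ at-x))))))) (cong proj₂ at-x)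
  translate-crossingRow g b leftward y o (k′ , j′) entry (_ , at-x) =
    trans (cong (_+ b) (sym (proj₂ (entry (inj₂ (+-cancelʳ-≡ x k′ 0 (cong proj₁ at-x))))))) (cong proj₂ at-x)

  -- An edge of a new link crossing line x is the entry or exit edge of its detour.
  newLink-crossing : ∀ i t y {a b} → Consecutive a b (newLink i) → Crossing x t y a b → EdgeAt C i (x , y) (suc x , y)
  newLink-crossing i t y c cross with view i
  ... | noCrossing _ detour≡ with subst (Consecutive _ _) (cong (λ r → anchor i ∷ r ++ [ anchor (suc i) ]) detour≡) c
  ...   | here₂ = ⊥-elim (embed-noCrossing (cell C i) (cell C (suc i)) (Crossing⇒CrossesLine t y cross))
  ...   | there₂ (there₂ ())
  newLink-crossing i t y {a} {b} c cross | crossing t′ y′ 1≤y′ c′ _ link≡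
    with Consecutive-map⁻ (translate x (baseOf y′)) (gadgetWalk (gadgetOf y′) t′) (subst (Consecutive a b) link≡ c)
  ... | o , o′ , c″ , refl , refl =
    subst (λ z → EdgeAt C i (x , z) (suc x , z)) (trans (sym (entryRow-gadgetOf y′ 1≤y′)) y′≡y) (Crossing⇒EdgeAt C t′ y′ c′)
    where
    y′≡y : entryRow (gadgetOf y′) + baseOf y′ ≡ y
    y′≡y = translate-crossingRow (gadgetOf y′) (baseOf y′) t y o o′
      (AllEdges-Consecutive _ (gadgetWalk-entry (gadgetOf y′) t′) c″) cross

  newCrosses⇒crosses : ∀ y → CrossSet newCycle x y → Crosses y
  newCrosses⇒crosses y (bounds , k , edge) with EdgeAt⇒Crossing newCycle edge
  ... | t , cross with Consecutive-chain⁻ anchor detour N (subst (Consecutive _ _) (sym chain≡newCells) (New.step-Consecutive k))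
  ...   | i , _ , c = bounds , i , newLink-crossing i t y c cross

  UsesEdge-embed : ∀ q r → UsesEdge C q r → ¬ CrossesLine x q r → UsesEdge newCycle (embed q) (embed r)
  UsesEdge-embed q r uses ¬cross with UsesEdge⇒EdgeAt uses
  ... | i , i<N , edge with view i
  ...   | crossing t y _ c _ _ = ⊥-elim (¬cross (edge-crosses edge))
    where
    edge-crosses : EdgeAt C i q r → CrossesLine x q r
    edge-crosses (inj₁ (refl , refl)) = Crossing⇒CrossesLine t y c
    edge-crosses (inj₂ (refl , refl)) = CrossesLine-swap (Crossing⇒CrossesLine t y c)
  ...   | noCrossing _ detour≡ = from-link edge
      (Consecutive-newLink⇒UsesEdge i i<N (subst (Consecutive _ _) (cong (λ r → anchor i ∷ r ++ [ anchor (suc i) ]) (sym detour≡)) here₂))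
    where
    from-link : EdgeAt C i q r → UsesEdge newCycle (anchor i) (anchor (suc i)) → UsesEdge newCycle (embed q) (embed r)
    from-link (inj₁ (refl , refl)) uses′ = uses′
    from-link (inj₂ (refl , refl)) uses′ = UsesEdge-swap {C = newCycle} uses′

  unfoldingLine-newCycle : UnfoldingLine C x → UnfoldingLine newCycle x
  unfoldingLine-newCycle ((1≤x , _) , extensible) =
    (1≤x , ≤-trans x<m (m≤m+n m 6)) , EvenlyExtensible-cong n Crosses (CrossSet newCycle x) crosses⇒newCrosses newCrosses⇒crosses extensible

  SameSide : Cell → Cell → Set
  SameSide q r = (proj₁ q ≤ x → proj₁ r ≤ x) × (proj₁ r ≤ x → proj₁ q ≤ x)

  sameSide-edge : ∀ q r → Adj q r → ¬ CrossesLine x q r → SameSide q r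
  sameSide-edge (a , b) (c , d) adj ¬cross with a ≤? x | c ≤? x
  ... | yes a≤x | yes c≤x = (λ _ → c≤x) , (λ _ → a≤x)
  ... | no a≰x  | no c≰x  = (λ a≤x → ⊥-elim (a≰x a≤x)) , (λ c≤x → ⊥-elim (c≰x c≤x))
  ... | yes a≤x | no c≰x  = ⊥-elim (¬cross (Adj-across x a b c d a≤x c≰x adj))
  ... | no a≰x  | yes c≤x = ⊥-elim (¬cross (CrossesLine-swap (Adj-across x c d a b c≤x a≰x (Adj-swap (a , b) (c , d) adj))))

  sameSide-head : ∀ q P → AllEdges SameSide (q ∷ P) → ∀ z → z ∈ q ∷ P → SameSide q z
  sameSide-head q P       _            z (here refl) = (λ le → le) , (λ le → le)
  sameSide-head q (r ∷ P) ((f , g) , s) z (there z∈) with sameSide-head r P s z z∈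
  ... | f′ , g′ = (λ le → f′ (f le)) , (λ le → g (g′ le))

  sameSide-edges : ∀ P → ContainsPath C P → AllEdges (λ q r → ¬ CrossesLine x q r) P → AllEdges SameSide P
  sameSide-edges []          _              _                  = tt
  sameSide-edges (q ∷ [])    _              _                  = tt
  sameSide-edges (q ∷ r ∷ P) (uses , usesᵣ) (¬cross , ¬crossᵣ) =
    sameSide-edge q r (UsesEdge⇒Adj C uses) ¬cross , sameSide-edges (r ∷ P) usesᵣ ¬crossᵣ

  sameSide-path : ∀ P → AllEdges SameSide P → ∀ z z′ → z ∈ P → z′ ∈ P → SameSide z z′
  sameSide-path (q ∷ P) sides z z′ z∈ z′∈ with sameSide-head q P sides z z∈ | sameSide-head q P sides z′ z′∈
  ... | f , g | f′ , g′ = (λ le → f′ (g le)) , (λ le → f (g′ le))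

  ContainsPath-embed : ∀ P → ContainsPath C P → AllEdges (λ q r → ¬ CrossesLine x q r) P
    → ContainsPath newCycle (map embed P)
  ContainsPath-embed []          _              _                  = tt
  ContainsPath-embed (q ∷ [])    _              _                  = tt
  ContainsPath-embed (q ∷ r ∷ P) (uses , usesᵣ) (¬cross , ¬crossᵣ) =
    UsesEdge-embed q r uses ¬cross , ContainsPath-embed (r ∷ P) usesᵣ ¬crossᵣ

  embed-noCrossings : ∀ P → AllEdges (λ q r → ¬ CrossesLine x q r) (map embed P)
  embed-noCrossings []          = tt
  embed-noCrossings (q ∷ [])    = tt
  embed-noCrossings (q ∷ r ∷ P) = embed-noCrossing q r , embed-noCrossings (r ∷ P)

  corner-∈ : ∀ c u v P → P ≡ Tpath c u v ⊎ P ≡ Upath c u v → c ∈ P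
  corner-∈ c u v P (inj₁ refl) = here refl
  corner-∈ c u v P (inj₂ refl) = there (there (there (there (there (there (there (here refl)))))))

  goodCorner-newCycle : 5 ≤ m → ∀ c u v P → CornerFrame m n c u v → (P ≡ Tpath c u v ⊎ P ≡ Upath c u v)
    → ContainsPath C P → AllEdges (λ q r → ¬ CrossesLine x q r) P → UnfoldingLine C x → GoodCorner newCycle
  goodCorner-newCycle 5≤m c u v P frame P≡ uses ¬crosses line with CornerFrame-widen frame
  ... | inj₁ (c≡ , frame′) =
    c , u , v , map embed P , frame′ , Sum.map (trans unmoved) (trans unmoved) P≡
      , ContainsPath-embed P uses ¬crosses , x , unfoldingLine-newCycle line , embed-noCrossings P
    where
    c≤x : proj₁ c ≤ x
    c≤x = subst (λ z → proj₁ z ≤ x) (sym c≡) 1≤x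
    unmoved : map embed P ≡ P
    unmoved = map-id-local (All.tabulate λ {z} z∈ →
      embed-left (proj₁ z) (proj₂ z) (proj₁ (sameSide-path P (sameSide-edges P uses ¬crosses) c z (corner-∈ c u v P P≡) z∈) c≤x))
  ... | inj₂ (c≡ , frame′) =
    shift6 c , u , v , map embed P , frame′
      , Sum.map (λ eq → trans shifted (trans (cong (map shift6) eq) (sym (Tpath-shift6 c u v (≤-trans 3≤5 5≤c)))))
                (λ eq → trans shifted (trans (cong (map shift6) eq) (sym (Upath-shift6 c u v 5≤c)))) P≡
      , ContainsPath-embed P uses ¬crosses , x , unfoldingLine-newCycle line , embed-noCrossings P
    where
    3≤5 : 3 ≤ 5
    3≤5 = s≤s (s≤s (s≤s z≤n))
    5≤c : 5 ≤ proj₁ c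
    5≤c = subst (λ z → 5 ≤ proj₁ z) (sym c≡) 5≤m
    c≰x : ¬ proj₁ c ≤ x
    c≰x c≤x = <⇒≱ x<m (subst (λ z → proj₁ z ≤ x) c≡ c≤x)
    shifted : map embed P ≡ map shift6 P
    shifted = map-cong-local (All.tabulate λ {z} z∈ →
      embed-right (proj₁ z) (proj₂ z) (≰⇒> λ z≤x → c≰x (proj₂ (sameSide-path P (sameSide-edges P uses ¬crosses) c z (corner-∈ c u v P P≡) z∈) z≤x)))

pairIndex-zigzagBlock : ∀ q j → j < 2 → pairIndex (j + oddRow q) ≡ q
pairIndex-zigzagBlock q zero          _ = pairIndex-oddRow q
pairIndex-zigzagBlock q (suc zero)    _ = pairIndex-evenRow q
pairIndex-zigzagBlock q (suc (suc j)) (s≤s (s≤s ()))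

pairIndex-extendedBlock : ∀ q j → j < 4 → pairIndex (j + oddRow q) ≡ q ⊎ pairIndex (j + oddRow q) ≡ suc q
pairIndex-extendedBlock q zero                   _ = inj₁ (pairIndex-oddRow q)
pairIndex-extendedBlock q (suc zero)             _ = inj₁ (pairIndex-evenRow q)
pairIndex-extendedBlock q (suc (suc zero))       _ =
  inj₂ (trans (cong pairIndex (sym (oddRow-suc q))) (pairIndex-oddRow (suc q)))
pairIndex-extendedBlock q (suc (suc (suc zero))) _ =
  inj₂ (trans (cong pairIndex (sym (evenRow-suc q))) (pairIndex-evenRow (suc q)))
pairIndex-extendedBlock q (suc (suc (suc (suc j)))) (s≤s (s≤s (s≤s (s≤s ()))))

extendedBlock-cover : ∀ q d → 1 ≤ d → (pairIndex d ≡ q ⊎ pairIndex d ≡ suc q) → ∃[ j ] (j < 4 × d ≡ j + oddRow q)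
extendedBlock-cover q d 1≤d (inj₁ pair≡) with row-pair d 1≤d
... | inj₁ d≡ = 0 , s≤s z≤n , trans d≡ (cong oddRow pair≡)
... | inj₂ d≡ = 1 , s≤s (s≤s z≤n) , trans d≡ (cong evenRow pair≡)
extendedBlock-cover q d 1≤d (inj₂ pair≡) with row-pair d 1≤d
... | inj₁ d≡ = 2 , s≤s (s≤s (s≤s z≤n)) , trans d≡ (trans (cong oddRow pair≡) (oddRow-suc q))
... | inj₂ d≡ = 3 , s≤s (s≤s (s≤s (s≤s z≤n))) , trans d≡ (trans (cong evenRow pair≡) (evenRow-suc q))

-- The crossing rows of an unfolding line occupy one row of every pair except the
-- (zero-based) pair a; the special crossing row is in a pair adjacent to it, and
-- the special gadget spans that pair and pair a, namely pairs p and p + 1.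
module PlacementFromCrossings {m n : ℕ} (C : HamCycle m n) (x : ℕ) (special : Gadget) (p h a : ℕ)
  (n≡h+h : n ≡ h + h)
  (crosses? : ∀ y → Dec (CrossSet C x y))
  (one-per-pair : ∀ q → ¬ (CrossSet C x (oddRow q) × CrossSet C x (evenRow q)))
  (a-empty₁ : ¬ CrossSet C x (oddRow a)) (a-empty₂ : ¬ CrossSet C x (evenRow a))
  (a-unique : ∀ q → q < h → ¬ CrossSet C x (oddRow q) → ¬ CrossSet C x (evenRow q) → q ≡ a)
  (special-crosses : CrossSet C x (entryRow special + oddRow p))
  (special-pairs : (pairIndex (entryRow special + oddRow p) ≡ suc p × a ≡ p)
                 ⊎ (pairIndex (entryRow special + oddRow p) ≡ p × a ≡ suc p))
  (special-height : height special ≡ 4) (special-straights : gadgetStraights special ≡ 4)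
  (top : evenRow (suc p) ≤ n) where

  open Layout C x special p

  crosses-pair : ∀ y → Crosses y → y ≡ oddRow (pairIndex y) ⊎ y ≡ evenRow (pairIndex y)
  crosses-pair y crosses = row-pair y (proj₁ (proj₁ crosses))

  crosses-pairIndex-injective : ∀ y y′ → Crosses y → Crosses y′ → pairIndex y ≡ pairIndex y′ → y ≡ y′
  crosses-pairIndex-injective y y′ cy cy′ eq with crosses-pair y cy | crosses-pair y′ cy′
  ... | inj₁ y≡ | inj₁ y′≡ = trans y≡ (trans (cong oddRow eq) (sym y′≡))
  ... | inj₂ y≡ | inj₂ y′≡ = trans y≡ (trans (cong evenRow eq) (sym y′≡))
  ... | inj₁ y≡ | inj₂ y′≡ =
    ⊥-elim (one-per-pair (pairIndex y) (subst Crosses y≡ cy , subst Crosses (trans y′≡ (cong evenRow (sym eq))) cy′))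
  ... | inj₂ y≡ | inj₁ y′≡ =
    ⊥-elim (one-per-pair (pairIndex y) (subst Crosses (trans y′≡ (cong oddRow (sym eq))) cy′ , subst Crosses y≡ cy))

  crosses-pairIndex≢a : ∀ y → Crosses y → pairIndex y ≢ a
  crosses-pairIndex≢a y cy eq with crosses-pair y cy
  ... | inj₁ y≡ = a-empty₁ (subst Crosses (trans y≡ (cong oddRow eq)) cy)
  ... | inj₂ y≡ = a-empty₂ (subst Crosses (trans y≡ (cong evenRow eq)) cy)

  specialPairs : ∀ q → q ≡ p ⊎ q ≡ suc p → q ≡ pairIndex specialRow ⊎ q ≡ a
  specialPairs q (inj₁ refl) = Sum.map (sym ∘ proj₁) (sym ∘ proj₂) (Sum.swap special-pairs)
  specialPairs q (inj₂ refl) = Sum.map (sym ∘ proj₁) (sym ∘ proj₂) special-pairs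

  a-pairs : a ≡ p ⊎ a ≡ suc p
  a-pairs = Sum.map proj₂ proj₂ special-pairs

  specialRow-pairs : pairIndex specialRow ≡ p ⊎ pairIndex specialRow ≡ suc p
  specialRow-pairs = Sum.swap (Sum.map proj₁ proj₁ special-pairs)

  special-height′ : height (gadgetOf specialRow) ≡ 4
  special-height′ = trans (cong (height ∘ proj₁) gadgetFor-specialRow) special-height

  special-base : baseOf specialRow ≡ oddRow p
  special-base = cong proj₂ gadgetFor-specialRow

  other-pairs : ∀ y → Crosses y → y ≢ specialRow → ¬ (pairIndex y ≡ p ⊎ pairIndex y ≡ suc p)
  other-pairs y cy y≢rs pairs with specialPairs (pairIndex y) pairs
  ... | inj₁ eq = y≢rs (crosses-pairIndex-injective y specialRow cy special-crosses eq)
  ... | inj₂ eq = crosses-pairIndex≢a y cy eq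

  blockRow-pair : ∀ y → Crosses y → ∀ j → j < height (gadgetOf y)
    → (y ≢ specialRow × pairIndex (j + baseOf y) ≡ pairIndex y)
    ⊎ (y ≡ specialRow × (pairIndex (j + baseOf y) ≡ p ⊎ pairIndex (j + baseOf y) ≡ suc p))
  blockRow-pair y cy j = byCases BlockRowPair specialRow y
    (λ j< → inj₂ (refl , subst (λ b → pairIndex (j + b) ≡ p ⊎ pairIndex (j + b) ≡ suc p) (sym special-base)
                             (pairIndex-extendedBlock p j (subst (j <_) special-height′ j<))))
    other
    where
    BlockRowPair : ℕ → Set
    BlockRowPair y = j < height (gadgetOf y)
      → (y ≢ specialRow × pairIndex (j + baseOf y) ≡ pairIndex y)
      ⊎ (y ≡ specialRow × (pairIndex (j + baseOf y) ≡ p ⊎ pairIndex (j + baseOf y) ≡ suc p))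
    other : y ≢ specialRow → BlockRowPair y
    other y≢rs j< with zigzag-otherRow y y≢rs (proj₁ (proj₁ cy))
    ... | base≡ , height≡ , _ = inj₁ (y≢rs , trans (cong (λ b → pairIndex (j + b)) base≡)
                                                (pairIndex-zigzagBlock (pairIndex y) j (subst (j <_) height≡ j<)))

  block-disjoint : ∀ y y′ → Crosses y → Crosses y′ → y ≢ y′ → ∀ j j′
    → j < height (gadgetOf y) → j′ < height (gadgetOf y′) → j + baseOf y ≢ j′ + baseOf y′
  block-disjoint y y′ cy cy′ y≢y′ j j′ j< j′< eq with blockRow-pair y cy j j< | blockRow-pair y′ cy′ j′ j′<
  ... | inj₁ (_ , e) | inj₁ (_ , e′) =
    y≢y′ (crosses-pairIndex-injective y y′ cy cy′ (trans (sym e) (trans (cong pairIndex eq) e′)))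
  ... | inj₁ (y≢rs , e) | inj₂ (refl , e′) =
    other-pairs y cy y≢rs (subst (λ z → z ≡ p ⊎ z ≡ suc p) (trans (sym (cong pairIndex eq)) e) e′)
  ... | inj₂ (refl , e) | inj₁ (y′≢rs , e′) =
    other-pairs y′ cy′ y′≢rs (subst (λ z → z ≡ p ⊎ z ≡ suc p) (trans (cong pairIndex eq) e′) e)
  ... | inj₂ (refl , _) | inj₂ (refl , _) = y≢y′ refl

  block-inGrid : ∀ y → Crosses y → ∀ j → j < height (gadgetOf y) → 1 ≤ j + baseOf y × j + baseOf y ≤ n
  block-inGrid y cy j = byCases BlockInGrid specialRow y
    (λ j< → subst (λ b → 1 ≤ j + b × j + b ≤ n) (sym special-base)
      ( ≤-trans (s≤s z≤n) (m≤n+m (oddRow p) j)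
      , ≤-trans (+-monoˡ-≤ (oddRow p) (≤-pred (subst (j <_) special-height′ j<))) (subst (_≤ n) (evenRow-suc p) top)))
    other
    where
    BlockInGrid : ℕ → Set
    BlockInGrid y = j < height (gadgetOf y) → 1 ≤ j + baseOf y × j + baseOf y ≤ n
    evenRow≤n : evenRow (pairIndex y) ≤ n
    evenRow≤n with crosses-pair y cy
    ... | inj₁ y≡ = subst (evenRow (pairIndex y) ≤_) (sym n≡h+h)
                      (oddRow≤⇒evenRow≤ (pairIndex y) h (subst₂ _≤_ y≡ n≡h+h (proj₂ (proj₁ cy))))
    ... | inj₂ y≡ = subst (_≤ n) y≡ (proj₂ (proj₁ cy))
    other : y ≢ specialRow → BlockInGrid y
    other y≢rs j< with zigzag-otherRow y y≢rs (proj₁ (proj₁ cy))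
    ... | base≡ , height≡ , _ = subst (λ b → 1 ≤ j + b × j + b ≤ n) (sym base≡)
      (≤-trans (s≤s z≤n) (m≤n+m (oddRow (pairIndex y)) j) , ≤-trans (+-monoˡ-≤ (oddRow (pairIndex y)) (≤-pred (subst (j <_) height≡ j<))) evenRow≤n)

  Covered : ℕ → Set
  Covered d = ∃[ y ] (Crosses y × ∃[ j ] (j < height (gadgetOf y) × d ≡ j + baseOf y))

  specialBlock-cover : ∀ d → 1 ≤ d → pairIndex d ≡ p ⊎ pairIndex d ≡ suc p → Covered d
  specialBlock-cover d 1≤d pairs with extendedBlock-cover p d 1≤d pairs
  ... | j , j<4 , d≡ = specialRow , special-crosses , j , subst (j <_) (sym special-height′) j<4
                         , trans d≡ (cong (j +_) (sym special-base))

  pair-cover : ∀ d y → 1 ≤ d → Crosses y → pairIndex y ≡ pairIndex d → Covered d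
  pair-cover d y 1≤d cy = byCases (λ y → pairIndex y ≡ pairIndex d → Covered d) specialRow y
    (λ same-pair → specialBlock-cover d 1≤d (subst (λ z → z ≡ p ⊎ z ≡ suc p) same-pair specialRow-pairs))
    other
    where
    other : y ≢ specialRow → pairIndex y ≡ pairIndex d → Covered d
    other y≢rs same-pair with zigzag-otherRow y y≢rs (proj₁ (proj₁ cy)) | row-pair d 1≤d
    ... | base≡ , height≡ , _ | inj₁ d≡ =
      y , cy , 0 , subst (0 <_) (sym height≡) (s≤s z≤n) , trans d≡ (trans (cong oddRow (sym same-pair)) (sym base≡))
    ... | base≡ , height≡ , _ | inj₂ d≡ =
      y , cy , 1 , subst (1 <_) (sym height≡) (s≤s (s≤s z≤n)) , trans d≡ (trans (cong evenRow (sym same-pair)) (cong suc (sym base≡)))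

  block-cover : ∀ d → 1 ≤ d → d ≤ n → Covered d
  block-cover d 1≤d d≤n with pairIndex d ≟ a
  ... | yes d∈a = specialBlock-cover d 1≤d (subst (λ z → z ≡ p ⊎ z ≡ suc p) (sym d∈a) a-pairs)
  ... | no d∉a with crosses? (oddRow (pairIndex d)) | crosses? (evenRow (pairIndex d))
  ...   | yes c | _     = pair-cover d _ 1≤d c (pairIndex-oddRow (pairIndex d))
  ...   | no _  | yes c = pair-cover d _ 1≤d c (pairIndex-evenRow (pairIndex d))
  ...   | no ¬c₁ | no ¬c₂ = ⊥-elim (d∉a (a-unique (pairIndex d) q<h ¬c₁ ¬c₂))
    where
    q<h : pairIndex d < h
    q<h with row-pair d 1≤d
    ... | inj₁ d≡ = oddRow≤⇒< (pairIndex d) h (subst₂ _≤_ d≡ n≡h+h d≤n)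
    ... | inj₂ d≡ = oddRow≤⇒< (pairIndex d) h (≤-trans (n≤1+n _) (subst₂ _≤_ d≡ n≡h+h d≤n))

  placement : Placement
  placement = record
    { block-inGrid       = block-inGrid
    ; block-disjoint     = block-disjoint
    ; block-cover        = block-cover
    ; specialRow-crosses = special-crosses
    ; special-straights  = special-straights
    }

even-of-%4≡2 : ∀ n → n % 4 ≡ 2 → ∃[ h ] (n ≡ h + h)
even-of-%4≡2 n n%4≡2 = suc (q * 2) , trans (m≡m%n+[m/n]*n n 4) (trans (cong (_+ q * 4) n%4≡2) (sym (double q)))
  where
  q = n / 4
  open +-*-Solver
  double : ∀ q → suc (q * 2) + suc (q * 2) ≡ 2 + q * 4
  double = solve 1 (λ q → (con 1 :+ q :* con 2) :+ (con 1 :+ q :* con 2) := con 2 :+ q :* con 4) refl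

record InsertionData {m n : ℕ} (C : HamCycle m n) (x : ℕ) : Set where
  field
    special   : Gadget
    p         : ℕ
    placement : Layout.Placement C x special p
    4≤n       : 4 ≤ n

decidable-by-list : ∀ {P : ℕ → Set} (L : List ℕ) → (∀ y → (y ∈ L) ⇔ P y) → ∀ y → Dec (P y)
decidable-by-list L L⇔P y with DecMembership._∈?_ _≟_ y L
... | yes y∈ = yes (Equivalence.to (L⇔P y) y∈)
... | no y∉  = no (λ Py → y∉ (Equivalence.from (L⇔P y) Py))

module ReadOff {m n : ℕ} (C : HamCycle m n) (x : ℕ) (n%4≡2 : n % 4 ≡ 2) where

  Crosses : ℕ → Set
  Crosses = CrossSet C x

  h : ℕ
  h = proj₁ (even-of-%4≡2 n n%4≡2)

  n≡h+h : n ≡ h + h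
  n≡h+h = proj₂ (even-of-%4≡2 n n%4≡2)

  n/2≡h : n / 2 ≡ h
  n/2≡h = trans (cong (_/ 2) (trans n≡h+h (trans (cong (h +_) (sym (+-identityʳ h))) (*-comm 2 h)))) (m*n/n≡m h 2)

  module AbsentPair (crosses? : ∀ y → Dec (Crosses y)) (one-per-pair : ∀ q → ¬ (Crosses (oddRow q) × Crosses (evenRow q)))
    (a₀ : ℕ) (a₀<h : a₀ < h) (a₀-empty₁ : ¬ Crosses (oddRow a₀)) (a₀-empty₂ : ¬ Crosses (evenRow a₀))
    (a₀-unique : ∀ q → q < h → ¬ Crosses (oddRow q) → ¬ Crosses (evenRow q) → q ≡ a₀) where

    build : ∀ special p → Crosses (entryRow special + oddRow p)
      → (pairIndex (entryRow special + oddRow p) ≡ suc p × a₀ ≡ p) ⊎ (pairIndex (entryRow special + oddRow p) ≡ p × a₀ ≡ suc p)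
      → height special ≡ 4 → gadgetStraights special ≡ 4 → evenRow (suc p) ≤ n → InsertionData C x
    build special p special-crosses special-pairs height≡ straights≡ top = record
      { special   = special
      ; p         = p
      ; placement = PlacementFromCrossings.placement C x special p h a₀ n≡h+h crosses? one-per-pair
                      a₀-empty₁ a₀-empty₂ a₀-unique special-crosses special-pairs height≡ straights≡ top
      ; 4≤n       = ≤-trans (s≤s (s≤s (s≤s (s≤s z≤n)))) (subst (_≤ n) (evenRow-suc p) top)
      }

    crossing-above : Crosses (suc (evenRow a₀)) → InsertionData C x
    crossing-above c = build extended-below a₀ c (inj₁ (cong suc (pairIndex-oddRow a₀) , refl)) refl refl
      (subst (evenRow (suc a₀) ≤_) (sym n≡h+h)
        (oddRow≤⇒evenRow≤ (suc a₀) h (subst₂ _≤_ (sym (oddRow-suc a₀)) n≡h+h (proj₂ (proj₁ c)))))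

    crossing-below : ∀ q → a₀ ≡ q → Crosses (q + q) → InsertionData C x
    crossing-below zero    _   c = ⊥-elim (1+n≰n (proj₁ (proj₁ c)))
    crossing-below (suc p) a₀≡ c =
      build extended-above p (subst Crosses (cong suc (+-suc p p)) c) (inj₂ (pairIndex-evenRow p , a₀≡)) refl refl
        (subst (_≤ n) (cong (λ z → suc (suc z)) (+-suc p (suc p)))
          (subst (_ ≤_) (sym n≡h+h) (+-mono-≤ 1+p<h 1+p<h)))
      where
      1+p<h : suc p < h
      1+p<h = subst (_< h) a₀≡ a₀<h

  -- The unique empty pair is a = a₀ + 1; the crossing next to it is in row 2a - 2 or 2a + 1.
  insertionData : UnfoldingLine C x → InsertionData C x
  insertionData (_ , _ , (L , _ , L⇔S , _) , one-per-pair , a , (1≤a , a≤) , ¬a₁ , ¬a₂ , a-unique , a-next) =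
    fromAbsentPair a 1≤a a≤ ¬a₁ ¬a₂ a-unique a-next
    where
    one-per-pair′ : ∀ q → ¬ (Crosses (oddRow q) × Crosses (evenRow q))
    one-per-pair′ q (c₁ , c₂) = one-per-pair (suc q) (s≤s z≤n)
      (subst Crosses (sym (2*suc∸1≡oddRow q)) c₁ , subst Crosses (sym (2*suc≡evenRow q)) c₂)

    fromAbsentPair : ∀ a → 1 ≤ a → a ≤ n / 2 → ¬ Crosses (2 * a ∸ 1) → ¬ Crosses (2 * a)
      → (∀ b → 1 ≤ b → b ≤ n / 2 → ¬ Crosses (2 * b ∸ 1) → ¬ Crosses (2 * b) → b ≡ a)
      → Crosses (2 * a ∸ 2) ⊎ Crosses (2 * a + 1) → InsertionData C x
    fromAbsentPair (suc a₀) _ a≤ ¬a₁ ¬a₂ a-unique a-next =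
      Sum.[ (λ c → crossing-below a₀ refl (subst Crosses (cong (_∸ 2) (2*suc≡evenRow a₀)) c))
          , (λ c → crossing-above (subst Crosses (trans (cong (_+ 1) (2*suc≡evenRow a₀)) (+-comm (evenRow a₀) 1)) c))
          ] a-next
      where
      open AbsentPair (decidable-by-list L L⇔S) one-per-pair′ a₀ (subst (suc a₀ ≤_) n/2≡h a≤)
        (λ c → ¬a₁ (subst Crosses (sym (2*suc∸1≡oddRow a₀)) c))
        (λ c → ¬a₂ (subst Crosses (sym (2*suc≡evenRow a₀)) c))
        (λ q q<h ¬c₁ ¬c₂ → suc-injective (a-unique (suc q) (s≤s z≤n) (subst (suc q ≤_) (sym n/2≡h) q<h)
          (λ c → ¬c₁ (subst Crosses (2*suc∸1≡oddRow q) c)) (λ c → ¬c₂ (subst Crosses (2*suc≡evenRow q) c))))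

cycleLength : ∀ N → 3 ≤ N → ∃[ K ] (N ≡ suc K × 2 < suc K)
cycleLength (suc K) (s≤s 2≤K) = K , refl , s≤s 2≤K

module Widening {m n : ℕ} (C : HamCycle m n) (x : ℕ) (n<m : n < m) (n%4≡2 : n % 4 ≡ 2)
  (line : UnfoldingLine C x) where

  open InsertionData (ReadOff.insertionData C x n%4≡2 line)

  5≤m : 5 ≤ m
  5≤m = ≤-trans (s≤s 4≤n) n<m

  period : ∃[ K ] (m * n ≡ suc K × 2 < suc K)
  period = cycleLength (m * n) (≤-trans (n≤1+n 3) (*-mono-≤ {1} {m} {4} {n} (≤-trans (s≤s z≤n) n<m) 4≤n))

  open Insertion C (proj₁ period) (proj₁ (proj₂ period)) (proj₂ (proj₂ period))
    x (proj₁ (proj₁ line)) (proj₂ (proj₁ line)) special p placement public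

  straights : numStraights newCycle ≡ numStraights C + 4
  straights = trans numStraights-newCycle (+-comm 4 (numStraights C))

  hasUnfoldingLine : HasUnfoldingLine newCycle
  hasUnfoldingLine = x , unfoldingLine-newCycle line

lemma22 : (m n k : ℕ) → n < m → n % 4 ≡ 2
    → (C : HamCycle m n) → numStraights C ≡ k → HasUnfoldingLine C
    → (∃[ C′ ] (numStraights {m + 6} {n} C′ ≡ k + 4 × HasUnfoldingLine C′))
      × (GoodCorner C
         → ∃[ C′ ] (numStraights {m + 6} {n} C′ ≡ k + 4 × HasUnfoldingLine C′ × GoodCorner C′))
lemma22 m n k n<m n%4≡2 C refl (x , line) = (W.newCycle , W.straights , W.hasUnfoldingLine) , keepCorner
  where
  module W = Widening C x n<m n%4≡2 line
  keepCorner : GoodCorner C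
    → ∃[ C′ ] (numStraights {m + 6} {n} C′ ≡ numStraights C + 4 × HasUnfoldingLine C′ × GoodCorner C′)
  keepCorner (c , u , v , P , frame , P≡ , uses , x′ , line′ , ¬crosses) =
    W′.newCycle , W′.straights , W′.hasUnfoldingLine , W′.goodCorner-newCycle W′.5≤m c u v P frame P≡ uses ¬crosses line′
    where module W′ = Widening C x′ n<m n%4≡2 line′
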